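{- Let $\mathcal{G}=(G,\mathbf{C})$ be a $p$-colored graph, let $S$ be a $\mathrm{vi}(k)$-set of $G$, and let $\varphi$ be an MSO formula with $s$ free vertex-set variables $X_1,\dots,X_s$ and $q$ quantifiers. Let $\mathbf{X}$ and $\mathbf{Y}$ be assignments of $\varphi$ whose $S$-shapes are equal. Then $(\mathcal{G},\mathbf{X})\models\varphi$ if and only if $(\mathcal{G},\mathbf{Y})\models\varphi$.
   Context: A $p$-colored graph is $\mathcal{G}=(G,\mathbf{C})$ with $G$ a finite simple graph and $\mathbf{C}=(C_1,\dots,C_p)$ a tuple of subsets of $V(G)$. The color set of $v$ is $\{i: v\in C_i\}$. A set $S\subseteq V(G)$ is a $\mathrm{vi}(k)$-set if every connected component of $G-S$ has at most $k-|S|$ vertices. MSO formulas over $p$-colored graphs use atomic formulas $E(x,y)$, $x=y$, $x\in X$, $x\in C_i$, $\mathrm{true}$, $\mathrm{false}$, the Boolean connectives, and quantifiers over vertex variables and vertex-set variables. An assignment is a tuple $\mathbf{X}=(X_1^G,\dots,X_s^G)$ of subsets of $V(G)$. For such $\mathbf{X}$, let $\mathcal{G}_{\mathbf{X}}=(G,(C_1,\dots,C_p,X_1^G,\dots,X_s^G))$, which is a $(p+s)$-colored graph. Types. For a colored graph $\mathcal{H}$ on $G$, two components $A_1,A_2$ of $G-S$ have the same $(\mathcal{H},S)$-type if there is a bijection $\psi\colon S\cup V(A_1)\to S\cup V(A_2)$ such that: - $\psi$ is the identity on $S$; - $\psi$ preserves adjacency and non-adjacency; - $\psi$ preserves the color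 set of every vertex. A type is an equivalence class of this relation. Let $\mathcal{T}'$ be the set of all possible $(\mathcal{H},S)$-types for $(p+s)$-colored graphs $\mathcal{H}$ obtained from $\mathcal{G}$ by adding $s$ new colors. Shapes. The $S$-shape of an assignment $\mathbf{X}$ is the pair $(\sigma_S,\sigma)$ defined as follows. - $\sigma_S\colon S\to 2^{\{X_1,\dots,X_s\}}$ is given by $\sigma_S(v)=\{X_i: v\in X_i^G\}$. - $\sigma\colon\mathcal{T}'\to[0,2^{kq}]\cup\{\top\}$ is given by $\sigma(t')=c(t')$ if $c(t')\le 2^{kq}$ and $\sigma(t')=\top$ otherwise, where $c(t')$ is the number of components of $G-S$ whose $(\mathcal{G}_{\mathbf{X}},S)$-type is $t'$. -}

module Defs where

open import Data.Nat using (ℕ; zero; suc; _+_; _*_; _^_; _≤_; _≤ᵇ_)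
open import Data.Bool using (Bool; true; false; if_then_else_)
open import Data.Maybe using (Maybe; just; nothing)
open import Data.Fin using (Fin; splitAt)
import Data.Fin as Fin
open import Data.Fin.Subset using (Subset; _∈_; _∉_; _∪_; ∣_∣)
open import Data.Sum using (_⊎_; inj₁; inj₂; [_,_]′)
open import Data.Product using (Σ; ∃; _×_; _,_)
open import Data.Unit using (⊤)
open import Data.Empty using (⊥)
open import Data.List using (List; length)
open import Data.List.Membership.Propositional using () renaming (_∈_ to _∈L_)
open import Data.List.Relation.Unary.Unique.Propositional using (Unique)
open import Relation.Binary.PropositionalEquality using (_≡_)
open import Relation.Nullary using (¬_)
open import Function using (_∘_)
open import Function.Bundles using (_⇔_)

record Graph (n : ℕ) : Set where
  field
    adj    : Fin n → Fin n → Bool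
    sym    : ∀ u v → adj u v ≡ adj v u
    irrefl : ∀ v → adj v v ≡ false
open Graph public

Colors : ℕ → ℕ → Set
Colors n p = Fin p → Subset n

Assignment : ℕ → ℕ → Set
Assignment n s = Fin s → Subset n

-- G_X : the (p+s)-colored graph (C₁,…,C_p,X₁,…,X_s)
extend : ∀ {n p s} → Colors n p → Assignment n s → Colors n (p + s)
extend {p = p} C X = [ C , X ]′ ∘ splitAt p

data Reach {n} (G : Graph n) (S : Subset n) (u : Fin n) : Fin n → Set where
  here : u ∉ S → Reach G S u u
  step : ∀ {w v} → Reach G S u w → adj G w v ≡ true → v ∉ S → Reach G S u v

IsComponent : ∀ {n} → Graph n → Subset n → Subset n → Set
IsComponent G S A =
  (∃ λ u → u ∈ A) × (∀ u v → u ∈ A → (v ∈ A ⇔ Reach G S u v))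

-- S is a vi(k)-set: every component A of G - S has |A| ≤ k - |S|
-- (stated as |S| + |A| ≤ k, i.e. with integer subtraction)
IsViSet : ∀ {n} → Graph n → ℕ → Subset n → Set
IsViSet G k S = ∀ A → IsComponent G S A → ∣ S ∣ + ∣ A ∣ ≤ k

-- Types: components A₁ (in colored graph with colors C₁) and A₂ (with
-- colors C₂) on the same G have the same type if there is a bijection
-- ψ : S ∪ A₁ → S ∪ A₂ (given by ψ and its inverse ψ⁻), identity on S,
-- preserving adjacency/non-adjacency and color sets.

SameType : ∀ {n c} → Graph n → Subset n →
           Colors n c → Subset n → Colors n c → Subset n → Set
SameType {n} G S C₁ A₁ C₂ A₂ =
  Σ (Fin n → Fin n) λ ψ → Σ (Fin n → Fin n) λ ψ⁻ →
    (∀ v → v ∈ S ∪ A₁ → ψ v ∈ S ∪ A₂ × ψ⁻ (ψ v) ≡ v) ×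
    (∀ w → w ∈ S ∪ A₂ → ψ⁻ w ∈ S ∪ A₁ × ψ (ψ⁻ w) ≡ w) ×
    (∀ v → v ∈ S → ψ v ≡ v) ×
    (∀ u v → u ∈ S ∪ A₁ → v ∈ S ∪ A₁ → adj G u v ≡ adj G (ψ u) (ψ v)) ×
    (∀ v → v ∈ S ∪ A₁ → ∀ i → (v ∈ C₁ i ⇔ ψ v ∈ C₂ i))

Count : ∀ {n} → (Subset n → Set) → ℕ → Set
Count {n} P c = Σ (List (Subset n)) λ L →
  Unique L × length L ≡ c × (∀ A → (A ∈L L ⇔ P A))

-- cap N c = c if c ≤ N, and ⊤ (represented by nothing) otherwise
cap : ℕ → ℕ → Maybe ℕ
cap N c = if c ≤ᵇ N then just c else nothing

-- Every type t' ∈ 𝒯' is the type of some component A of G - S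
-- in some (p+s)-colored graph G_Z; so σ_X = σ_Y says that for every such
-- representative, the capped numbers of components of G - S of that type
-- in G_X and in G_Y agree.

SameShape : ∀ {n p s} → Graph n → Colors n p → Subset n → ℕ → ℕ →
            Assignment n s → Assignment n s → Set
SameShape {n} {p} {s} G C S k q X Y =
  (∀ v → v ∈ S → ∀ i → (v ∈ X i ⇔ v ∈ Y i)) ×
  (∀ (Z : Assignment n s) (A : Subset n) → IsComponent G S A →
     ∀ c₁ c₂ →
     Count (λ B → IsComponent G S B × SameType G S (extend C X) B (extend C Z) A) c₁ →
     Count (λ B → IsComponent G S B × SameType G S (extend C Y) B (extend C Z) A) c₂ →
     cap (2 ^ (k * q)) c₁ ≡ cap (2 ^ (k * q)) c₂)

data Formula (p : ℕ) : ℕ → ℕ → Set where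
  edge  : ∀ {v s} → Fin v → Fin v → Formula p v s
  equal : ∀ {v s} → Fin v → Fin v → Formula p v s
  mem   : ∀ {v s} → Fin v → Fin s → Formula p v s
  col   : ∀ {v s} → Fin v → Fin p → Formula p v s
  tt ff : ∀ {v s} → Formula p v s
  not   : ∀ {v s} → Formula p v s → Formula p v s
  and or imp iff : ∀ {v s} → Formula p v s → Formula p v s → Formula p v s
  exV allV : ∀ {v s} → Formula p (suc v) s → Formula p v s
  exS allS : ∀ {v s} → Formula p v (suc s) → Formula p v s

quantifiers : ∀ {p v s} → Formula p v s → ℕ
quantifiers (edge _ _) = 0
quantifiers (equal _ _) = 0
quantifiers (mem _ _) = 0
quantifiers (col _ _) = 0
quantifiers tt = 0
quantifiers ff = 0
quantifiers (not φ) = quantifiers φ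
quantifiers (and φ ψ) = quantifiers φ + quantifiers ψ
quantifiers (or φ ψ) = quantifiers φ + quantifiers ψ
quantifiers (imp φ ψ) = quantifiers φ + quantifiers ψ
quantifiers (iff φ ψ) = quantifiers φ + quantifiers ψ
quantifiers (exV φ) = suc (quantifiers φ)
quantifiers (allV φ) = suc (quantifiers φ)
quantifiers (exS φ) = suc (quantifiers φ)
quantifiers (allS φ) = suc (quantifiers φ)

extendEnv : ∀ {A : Set} {m} → A → (Fin m → A) → Fin (suc m) → A
extendEnv a ρ Fin.zero = a
extendEnv a ρ (Fin.suc i) = ρ i

Sat : ∀ {n p v s} → Graph n → Colors n p → (Fin v → Fin n) →
      Assignment n s → Formula p v s → Set
Sat G C ρ X (edge x y)  = adj G (ρ x) (ρ y) ≡ true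
Sat G C ρ X (equal x y) = ρ x ≡ ρ y
Sat G C ρ X (mem x i)   = ρ x ∈ X i
Sat G C ρ X (col x i)   = ρ x ∈ C i
Sat G C ρ X tt          = ⊤
Sat G C ρ X ff          = ⊥
Sat G C ρ X (not φ)     = ¬ Sat G C ρ X φ
Sat G C ρ X (and φ ψ)   = Sat G C ρ X φ × Sat G C ρ X ψ
Sat G C ρ X (or φ ψ)    = Sat G C ρ X φ ⊎ Sat G C ρ X ψ
Sat G C ρ X (imp φ ψ)   = Sat G C ρ X φ → Sat G C ρ X ψ
Sat G C ρ X (iff φ ψ)   = Sat G C ρ X φ ⇔ Sat G C ρ X ψ
Sat G C ρ X (exV φ)     = Σ _ λ u → Sat G C (extendEnv u ρ) X φ
Sat G C ρ X (allV φ)    = ∀ u → Sat G C (extendEnv u ρ) X φ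
Sat G C ρ X (exS φ)     = Σ (Subset _) λ U → Sat G C ρ (extendEnv U X) φ
Sat G C ρ X (allS φ)    = ∀ U → Sat G C ρ (extendEnv U X) φ

noVars : ∀ {n} → Fin 0 → Fin n
noVars ()

_,_⊨_ : ∀ {n p s} → (Graph n × Colors n p) → Assignment n s → Formula p 0 s → Set
(G , C) , X ⊨ φ = Sat G C noVars X φ

-- Ehrenfeucht–Fraïssé argument.  A position of the game (set variables X,
-- vertex variables ρ) is summarised by its restriction to S and, for every
-- isomorphism type of S together with a component of G - S, the number of
-- components of that type, counted up to a threshold.  Duplicator answers a
-- vertex move in S by the same vertex, and any other vertex by its image in a
-- component of the same type.  She answers a set move U by cutting, within
-- each class of components of equal type, her components in the same
-- patterns as U cuts Spoiler's, with the multiplicities of the patterns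
-- rebalanced to agree up to the next threshold.  A component has at most k
-- vertices and hence at most 2^k patterns, so thresholds 2^(kq) - 1 survive q
-- quantifiers, and similar positions satisfy the same atomic formulas.

module Submission where

open import Data.Nat
open import Data.Nat.Properties
open import Data.Bool using (true; false)
import Data.Bool as Bool
open import Data.Fin using (Fin; zero; suc; splitAt; _↑ˡ_; _↑ʳ_)
import Data.Fin.Properties as Fin
open import Data.Fin.Subset using (Subset; _∈_; _∉_; _⊆_; _∪_; _∩_; ∣_∣; inside; outside)
import Data.Fin.Subset as Subset
open import Data.Fin.Subset.Properties
  using (_∈?_; ⊆-antisym; p⊆p∪q; x∈p∪q⁻; x∈p∪q⁺; x∈p∩q⁺; x∈p∩q⁻; p⊂q⇒∣p∣<∣q∣; ∣p∣≤n;
         x∈p⇒∣p-x∣<∣p∣; ⊥⊆; drop-∷-⊆; s⊆s; out⊆)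
open import Data.Vec using ([]; _∷_; tabulate)
import Data.Vec.Properties as Vec
open import Data.List using (List; []; _∷_; map; length; filter; _++_; replicate; allFin; deduplicate)
open import Data.List.Properties using (length-++; length-replicate; length-map)
open import Data.List.Membership.Propositional using () renaming (_∈_ to _∈L_)
open import Data.List.Membership.Propositional.Properties
  using (∈-map⁺; ∈-map⁻; ∈-filter⁺; ∈-filter⁻; ∈-++⁺ˡ; ∈-++⁺ʳ; ∈-++⁻; ∈-allFin; ∈-deduplicate⁺; ∈-deduplicate⁻)
open import Data.List.Relation.Unary.Any using (here; there)
import Data.List.Relation.Unary.All as All
open import Data.List.Relation.Unary.AllPairs using (_∷_; [])
open import Data.List.Relation.Unary.Unique.Propositional using (Unique)
import Data.List.Relation.Unary.Unique.Propositional.Properties as Unique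
import Data.List.Relation.Unary.Unique.DecPropositional.Properties as UniqueDec
open import Data.Product hiding (map)
open import Data.Sum using (_⊎_; inj₁; inj₂; [_,_]′)
import Data.Sum as Sum
open import Data.Empty using (⊥; ⊥-elim)
open import Relation.Nullary
open import Relation.Nullary.Decidable using (dec-true)
open import Relation.Binary.PropositionalEquality
open import Relation.Binary.Definitions using (DecidableEquality)
open import Function.Bundles using (_⇔_; mk⇔; Equivalence)
import Function.Properties.Equivalence as ⇔
open import Defs hiding (sym)

open Equivalence using (to; from)

_⇔-dec_ : ∀ {A B : Set} → Dec A → Dec B → Dec (A ⇔ B)
a ⇔-dec b = map′ (uncurry mk⇔) (λ e → to e , from e) ((a →-dec b) ×-dec (b →-dec a))

⇔-subst : ∀ {A : Set} (P : A → Set) {x y} → x ≡ y → P x ⇔ P y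
⇔-subst P refl = ⇔.refl

subsetOf : ∀ {n} {P : Fin n → Set} → (∀ v → Dec (P v)) → Subset n
subsetOf P? = tabulate (λ v → does (P? v))

∈-subsetOf⁺ : ∀ {n} {P : Fin n → Set} (P? : ∀ v → Dec (P v)) {v} → P v → v ∈ subsetOf P?
∈-subsetOf⁺ P? {v} pv = Vec.lookup⇒[]= v _ (trans (Vec.lookup∘tabulate _ v) (dec-true (P? v) pv))

∈-subsetOf⁻ : ∀ {n} {P : Fin n → Set} (P? : ∀ v → Dec (P v)) {v} → v ∈ subsetOf P? → P v
∈-subsetOf⁻ P? {v} m with P? v | trans (sym (Vec.lookup∘tabulate (λ v → does (P? v)) v)) (Vec.[]=⇒lookup m)
... | yes pv | _ = pv
... | no _   | ()

subset-ext : ∀ {n} {p q : Subset n} → (∀ v → v ∈ p → v ∈ q) → (∀ v → v ∈ q → v ∈ p) → p ≡ q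
subset-ext f g = ⊆-antisym (λ {x} → f x) (λ {x} → g x)

_≟ₛ_ : ∀ {n} → DecidableEquality (Subset n)
_≟ₛ_ = Vec.≡-dec Bool._≟_

cons : ∀ {m n} → Fin n → (Fin m → Fin n) → Fin (suc m) → Fin n
cons a g zero    = a
cons a g (suc i) = g i

∃-function? : ∀ m {n} (P : (Fin m → Fin n) → Set) →
              (∀ f g → (∀ i → f i ≡ g i) → P f → P g) → (∀ f → Dec (P f)) →
              Dec (Σ (Fin m → Fin n) P)
∃-function? zero P resp P? with P? (λ ())
... | yes p = yes (_ , p)
... | no ¬p = no (λ (f , pf) → ¬p (resp f (λ ()) (λ ()) pf))
∃-function? (suc m) {n} P resp P? with ∃-function? m P′ resp′ (λ g → Fin.any? (λ a → P? (cons a g)))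
  where
    P′ : (Fin m → Fin n) → Set
    P′ g = Σ (Fin n) λ a → P (cons a g)
    resp′ : ∀ f g → (∀ i → f i ≡ g i) → P′ f → P′ g
    resp′ f g e (a , p) = a , resp (cons a f) (cons a g) (λ { zero → refl ; (suc i) → e i }) p
... | yes (g , a , p) = yes (cons a g , p)
... | no ¬p = no (λ (f , pf) → ¬p ((λ i → f (suc i)) , f zero , resp f _ (λ { zero → refl ; (suc i) → refl }) pf))

-- Counts compare like the paper's capped values, with ⊤ for counts above T.

infix 4 _≈[_]_
_≈[_]_ : ℕ → ℕ → ℕ → Set
a ≈[ T ] b = a ≡ b ⊎ (T < a × T < b)

≈-sym : ∀ {a b T} → a ≈[ T ] b → b ≈[ T ] a
≈-sym (inj₁ e)       = inj₁ (sym e)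
≈-sym (inj₂ (x , y)) = inj₂ (y , x)

≈-mono : ∀ {a b T T′} → T′ ≤ T → a ≈[ T ] b → a ≈[ T′ ] b
≈-mono le (inj₁ e)       = inj₁ e
≈-mono le (inj₂ (x , y)) = inj₂ (≤-<-trans le x , ≤-<-trans le y)

≈-positive : ∀ {a b T} → a ≈[ T ] b → 0 < a → 0 < b
≈-positive (inj₁ refl)    p = p
≈-positive (inj₂ (_ , y)) _ = ≤-<-trans z≤n y

≈-+ : ∀ {a b c d T} → a ≈[ T ] b → c ≈[ T ] d → a + c ≈[ T ] b + d
≈-+ (inj₁ refl) (inj₁ refl) = inj₁ refl
≈-+ {a} {b} {c} {d} (inj₁ refl) (inj₂ (x , y)) = inj₂ (<-≤-trans x (m≤n+m c a) , <-≤-trans y (m≤n+m d a))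
≈-+ {a} {b} {c} {d} (inj₂ (x , y)) _ = inj₂ (<-≤-trans x (m≤m+n a c) , <-≤-trans y (m≤m+n b d))

≈-pred : ∀ {a b T T′} → suc a ≈[ T ] suc b → T′ < T → a ≈[ T′ ] b
≈-pred (inj₁ refl)              _  = inj₁ refl
≈-pred (inj₂ (s≤s x , s≤s y)) lt = inj₂ (<-≤-trans lt x , <-≤-trans lt y)

cap-≡⇒≈ : ∀ N a b → cap N a ≡ cap N b → a ≈[ N ] b
cap-≡⇒≈ N a b e with a ≤ᵇ N in ea | b ≤ᵇ N in eb
cap-≡⇒≈ N a b refl | true  | true  = inj₁ refl
cap-≡⇒≈ N a b ()   | true  | false
cap-≡⇒≈ N a b ()   | false | true
cap-≡⇒≈ N a b e    | false | false = inj₂ (exceeds ea , exceeds eb)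
  where
    exceeds : ∀ {x} → (x ≤ᵇ N) ≡ false → N < x
    exceeds {x} e = ≰⇒> (λ le → subst Bool.T e (≤⇒≤ᵇ le))

module _ {A : Set} where

  count : {P : A → Set} → (∀ x → Dec (P x)) → List A → ℕ
  count P? [] = 0
  count P? (x ∷ xs) with P? x
  ... | yes _ = suc (count P? xs)
  ... | no _  = count P? xs

  count-cong : ∀ {P Q : A → Set} (P? : ∀ x → Dec (P x)) (Q? : ∀ x → Dec (Q x)) xs →
               (∀ x → x ∈L xs → P x → Q x) → (∀ x → x ∈L xs → Q x → P x) →
               count P? xs ≡ count Q? xs
  count-cong P? Q? [] f g = refl
  count-cong P? Q? (x ∷ xs) f g with P? x | Q? x
  ... | yes p | yes q = cong suc (count-cong P? Q? xs (λ y m → f y (there m)) (λ y m → g y (there m)))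
  ... | yes p | no ¬q = ⊥-elim (¬q (f x (here refl) p))
  ... | no ¬p | yes q = ⊥-elim (¬p (g x (here refl) q))
  ... | no ¬p | no ¬q = count-cong P? Q? xs (λ y m → f y (there m)) (λ y m → g y (there m))

  count≡0 : ∀ {P : A → Set} (P? : ∀ x → Dec (P x)) xs → (∀ x → x ∈L xs → ¬ P x) → count P? xs ≡ 0
  count≡0 P? [] f = refl
  count≡0 P? (x ∷ xs) f with P? x
  ... | yes p = ⊥-elim (f x (here refl) p)
  ... | no _  = count≡0 P? xs (λ y m → f y (there m))

  count>0 : ∀ {P : A → Set} (P? : ∀ x → Dec (P x)) xs {x} → x ∈L xs → P x → 0 < count P? xs
  count>0 P? (y ∷ xs) (here refl) px with P? y
  ... | yes _ = s≤s z≤n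
  ... | no ¬p = ⊥-elim (¬p px)
  count>0 P? (y ∷ xs) (there m) px with P? y
  ... | yes _ = s≤s z≤n
  ... | no _  = count>0 P? xs m px

  count>0⇒∃ : ∀ {P : A → Set} (P? : ∀ x → Dec (P x)) xs → 0 < count P? xs → ∃ λ x → x ∈L xs × P x
  count>0⇒∃ P? (y ∷ xs) lt with P? y
  ... | yes p = y , here refl , p
  ... | no _ with count>0⇒∃ P? xs lt
  ...   | x , m , p = x , there m , p

  count≡1 : ∀ {P : A → Set} (P? : ∀ x → Dec (P x)) xs {b} → Unique xs → b ∈L xs →
            (∀ x → x ∈L xs → P x → x ≡ b) → P b → count P? xs ≡ 1
  count≡1 P? (y ∷ xs) (u ∷ us) (here refl) f pb with P? y
  ... | no ¬p = ⊥-elim (¬p pb)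
  ... | yes _ = cong suc (count≡0 P? xs (λ x m px → All.lookup u m (sym (f x (there m) px))))
  count≡1 P? (y ∷ xs) (u ∷ us) (there bm) f pb with P? y
  ... | yes py = ⊥-elim (All.lookup u bm (f y (here refl) py))
  ... | no _   = count≡1 P? xs us bm (λ x m px → f x (there m) px) pb

  count-remove : ∀ {P : A → Set} (P? : ∀ x → Dec (P x)) (_≟_ : DecidableEquality A) xs {b} →
                 Unique xs → b ∈L xs → P b →
                 count P? xs ≡ suc (count (λ x → P? x ×-dec ¬? (x ≟ b)) xs)
  count-remove P? _≟_ (y ∷ xs) (u ∷ us) (here refl) pb with P? y | y ≟ y
  ... | no ¬p | _     = ⊥-elim (¬p pb)
  ... | yes _ | no ne = ⊥-elim (ne refl)
  ... | yes _ | yes _ = cong suc (count-cong P? _ xs (λ x m px → px , λ e → All.lookup u m (sym e))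
                                                     (λ x m pq → proj₁ pq))
  count-remove P? _≟_ (y ∷ xs) {b} (u ∷ us) (there bm) pb with P? y | y ≟ b
  ... | yes _ | yes refl = ⊥-elim (All.lookup u bm refl)
  ... | yes _ | no _     = cong suc (count-remove P? _≟_ xs us bm pb)
  ... | no _  | _        = count-remove P? _≟_ xs us bm pb

  count-filter : ∀ {P Q : A → Set} (P? : ∀ x → Dec (P x)) (Q? : ∀ x → Dec (Q x)) xs →
                 count P? (filter Q? xs) ≡ count (λ x → Q? x ×-dec P? x) xs
  count-filter P? Q? [] = refl
  count-filter P? Q? (x ∷ xs) with Q? x
  ... | no _ = count-filter P? Q? xs
  ... | yes _ with P? x
  ...   | yes _ = cong suc (count-filter P? Q? xs)
  ...   | no _  = count-filter P? Q? xs

  count-split : ∀ {P Q : A → Set} (P? : ∀ x → Dec (P x)) (Q? : ∀ x → Dec (Q x)) xs →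
                count P? xs ≡ count (λ x → P? x ×-dec Q? x) xs + count (λ x → P? x ×-dec ¬? (Q? x)) xs
  count-split P? Q? [] = refl
  count-split P? Q? (x ∷ xs) with P? x
  ... | no _ = count-split P? Q? xs
  ... | yes _ with Q? x
  ...   | yes _ = cong suc (count-split P? Q? xs)
  ...   | no _  = trans (cong suc (count-split P? Q? xs)) (sym (+-suc _ _))

  count-++ : ∀ {P : A → Set} (P? : ∀ x → Dec (P x)) xs ys → count P? (xs ++ ys) ≡ count P? xs + count P? ys
  count-++ P? [] ys = refl
  count-++ P? (x ∷ xs) ys with P? x
  ... | yes _ = cong suc (count-++ P? xs ys)
  ... | no _  = count-++ P? xs ys

  count-replicate-yes : ∀ {P : A → Set} (P? : ∀ x → Dec (P x)) m {x} → P x → count P? (replicate m x) ≡ m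
  count-replicate-yes P? zero px = refl
  count-replicate-yes P? (suc m) {x} px with P? x
  ... | yes _ = cong suc (count-replicate-yes P? m px)
  ... | no ¬p = ⊥-elim (¬p px)

  count-replicate-no : ∀ {P : A → Set} (P? : ∀ x → Dec (P x)) m {x} → ¬ P x → count P? (replicate m x) ≡ 0
  count-replicate-no P? zero ¬px = refl
  count-replicate-no P? (suc m) {x} ¬px with P? x
  ... | yes p = ⊥-elim (¬px p)
  ... | no _  = count-replicate-no P? m ¬px

  count-mono : ∀ {P Q : A → Set} (P? : ∀ x → Dec (P x)) (Q? : ∀ x → Dec (Q x)) xs →
               (∀ x → P x → Q x) → count P? xs ≤ count Q? xs
  count-mono P? Q? [] f = z≤n
  count-mono P? Q? (x ∷ xs) f with P? x | Q? x
  ... | yes p | yes q = s≤s (count-mono P? Q? xs f)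
  ... | yes p | no ¬q = ⊥-elim (¬q (f x p))
  ... | no _  | yes _ = m≤n⇒m≤1+n (count-mono P? Q? xs f)
  ... | no _  | no _  = count-mono P? Q? xs f

  length-filter≡count : ∀ {P : A → Set} (P? : ∀ x → Dec (P x)) xs → length (filter P? xs) ≡ count P? xs
  length-filter≡count P? [] = refl
  length-filter≡count P? (x ∷ xs) with P? x
  ... | yes _ = cong suc (length-filter≡count P? xs)
  ... | no _  = length-filter≡count P? xs

  length≡count+length-filter¬ : ∀ {P : A → Set} (P? : ∀ x → Dec (P x)) xs →
                                length xs ≡ count P? xs + length (filter (λ x → ¬? (P? x)) xs)
  length≡count+length-filter¬ P? [] = refl
  length≡count+length-filter¬ P? (x ∷ xs) with P? x
  ... | yes _ = cong suc (length≡count+length-filter¬ P? xs)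
  ... | no _  = trans (cong suc (length≡count+length-filter¬ P? xs)) (sym (+-suc _ _))

  findOr : {P : A → Set} → A → (∀ x → Dec (P x)) → List A → A
  findOr d P? [] = d
  findOr d P? (x ∷ xs) with P? x
  ... | yes _ = x
  ... | no _  = findOr d P? xs

  findOr-spec : ∀ {P : A → Set} d (P? : ∀ x → Dec (P x)) xs {y} → y ∈L xs → P y →
                findOr d P? xs ∈L xs × P (findOr d P? xs)
  findOr-spec d P? (x ∷ xs) m py with P? x
  ... | yes px = here refl , px
  findOr-spec d P? (x ∷ xs) (here refl) py | no ¬px = ⊥-elim (¬px py)
  findOr-spec d P? (x ∷ xs) (there m)   py | no ¬px = map₁ there (findOr-spec d P? xs m py)

  findOr-cong : ∀ {P Q : A → Set} d (P? : ∀ x → Dec (P x)) (Q? : ∀ x → Dec (Q x)) xs →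
                (∀ x → x ∈L xs → P x → Q x) → (∀ x → x ∈L xs → Q x → P x) →
                findOr d P? xs ≡ findOr d Q? xs
  findOr-cong d P? Q? [] f g = refl
  findOr-cong d P? Q? (x ∷ xs) f g with P? x | Q? x
  ... | yes _ | yes _ = refl
  ... | yes p | no ¬q = ⊥-elim (¬q (f x (here refl) p))
  ... | no ¬p | yes q = ⊥-elim (¬p (g x (here refl) q))
  ... | no _  | no _  = findOr-cong d P? Q? xs (λ y m → f y (there m)) (λ y m → g y (there m))

count-map : ∀ {A B : Set} {P : B → Set} (P? : ∀ x → Dec (P x)) (f : A → B) xs →
            count P? (map f xs) ≡ count (λ x → P? (f x)) xs
count-map P? f [] = refl
count-map P? f (x ∷ xs) with P? (f x)
... | yes _ = cong suc (count-map P? f xs)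
... | no _  = count-map P? f xs

-- Multisets of keys, represented by lists

module Multiset {K : Set} (_≟K_ : DecidableEquality K) where

  multiplicity : K → List K → ℕ
  multiplicity κ = count (λ z → z ≟K κ)

  private
    ≢? : ∀ κ (z : K) → Dec (z ≢ κ)
    ≢? κ z = ¬? (z ≟K κ)

    ⊆[]⇒≡[] : (xs : List K) → (∀ z → z ∈L xs → z ∈L []) → xs ≡ []
    ⊆[]⇒≡[] [] f = refl
    ⊆[]⇒≡[] (x ∷ xs) f with f x (here refl)
    ... | ()

    filter-≢-⊆ : ∀ {κ E} xs → (∀ z → z ∈L xs → z ∈L κ ∷ E) → ∀ z → z ∈L filter (≢? κ) xs → z ∈L E
    filter-≢-⊆ {κ} xs f z m with ∈-filter⁻ (≢? κ) {xs = xs} m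
    ... | mz , z≢κ with f z mz
    ...   | here z≡κ = ⊥-elim (z≢κ z≡κ)
    ...   | there m′ = m′

    ∈-replicate⁻ : ∀ {z κ : K} r → z ∈L replicate r κ → z ≡ κ
    ∈-replicate⁻ (suc r) (here e)  = e
    ∈-replicate⁻ (suc r) (there m) = ∈-replicate⁻ r m

  -- Induction on the universe E: split off the key κ and recurse on the
  -- sublists without κ, whose other multiplicities are unchanged.
  ≈-multiplicity⇒≈-count : ∀ T E → Unique E → ∀ xs ys →
    (∀ z → z ∈L xs → z ∈L E) → (∀ z → z ∈L ys → z ∈L E) →
    (∀ κ → κ ∈L E → multiplicity κ xs ≈[ T ] multiplicity κ ys) →
    ∀ {P : K → Set} (P? : ∀ x → Dec (P x)) → count P? xs ≈[ T ] count P? ys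
  ≈-multiplicity⇒≈-count T [] _ xs ys fx fy _ P?
    rewrite ⊆[]⇒≡[] xs fx | ⊆[]⇒≡[] ys fy = inj₁ refl
  ≈-multiplicity⇒≈-count T (κ ∷ E) (u ∷ us) xs ys fx fy h {P} P? =
    subst₂ (_≈[ T ]_) (sym (count-split P? (_≟K κ) xs)) (sym (count-split P? (_≟K κ) ys))
      (≈-+ withκ withoutκ)
    where
      withκ : count (λ z → P? z ×-dec (z ≟K κ)) xs ≈[ T ] count (λ z → P? z ×-dec (z ≟K κ)) ys
      withκ with P? κ
      ... | yes pκ = subst₂ (_≈[ T ]_)
              (count-cong (_≟K κ) _ xs (λ z _ e → subst P (sym e) pκ , e) (λ z _ p → proj₂ p))
              (count-cong (_≟K κ) _ ys (λ z _ e → subst P (sym e) pκ , e) (λ z _ p → proj₂ p))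
              (h κ (here refl))
      ... | no ¬pκ = inj₁ (trans (count≡0 _ xs (λ z _ (p , e) → ¬pκ (subst P e p)))
                                 (sym (count≡0 _ ys (λ z _ (p , e) → ¬pκ (subst P e p)))))
      as-filter : ∀ zs → count (λ z → P? z ×-dec ≢? κ z) zs ≡ count P? (filter (≢? κ) zs)
      as-filter zs = trans (count-cong _ _ zs (λ z _ → swap) (λ z _ → swap)) (sym (count-filter P? (≢? κ) zs))
      multiplicity-filter : ∀ zs κ′ → κ′ ∈L E → multiplicity κ′ (filter (≢? κ) zs) ≡ multiplicity κ′ zs
      multiplicity-filter zs κ′ m = trans (count-filter _ (≢? κ) zs)
        (count-cong _ _ zs (λ z _ → proj₂) (λ z _ e → (λ e′ → All.lookup u m (trans (sym e′) e)) , e))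
      withoutκ : count (λ z → P? z ×-dec ≢? κ z) xs ≈[ T ] count (λ z → P? z ×-dec ≢? κ z) ys
      withoutκ = subst₂ (_≈[ T ]_) (sym (as-filter xs)) (sym (as-filter ys))
        (≈-multiplicity⇒≈-count T E us (filter (≢? κ) xs) (filter (≢? κ) ys)
          (filter-≢-⊆ xs fx) (filter-≢-⊆ ys fy)
          (λ κ′ m → subst₂ (_≈[ T ]_) (sym (multiplicity-filter xs κ′ m)) (sym (multiplicity-filter ys κ′ m))
                                       (h κ′ (there m)))
          P?)

  length≤ : ∀ E xs m → (∀ z → z ∈L xs → z ∈L E) → (∀ κ → κ ∈L E → multiplicity κ xs ≤ m) →
            length xs ≤ length E * m
  length≤ [] xs m f g rewrite ⊆[]⇒≡[] xs f = z≤n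
  length≤ (κ ∷ E) xs m f g = begin
      length xs                                    ≡⟨ length≡count+length-filter¬ (_≟K κ) xs ⟩
      multiplicity κ xs + length (filter (≢? κ) xs) ≤⟨ +-mono-≤ (g κ (here refl)) (length≤ E _ m (filter-≢-⊆ xs f) rest) ⟩
      m + length E * m                             ∎
    where
      open ≤-Reasoning
      rest : ∀ κ′ → κ′ ∈L E → multiplicity κ′ (filter (≢? κ) xs) ≤ m
      rest κ′ m′ = ≤-trans (≤-trans (≤-reflexive (count-filter _ (≢? κ) xs)) (count-mono _ _ xs (λ _ → proj₂)))
                           (g κ′ (there m′))

  copies : (K → ℕ) → List K → List K
  copies d []      = []
  copies d (κ ∷ E) = replicate (d κ) κ ++ copies d E

  ∈-copies⁻ : ∀ d E z → z ∈L copies d E → z ∈L E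
  ∈-copies⁻ d (κ ∷ E) z m with ∈-++⁻ (replicate (d κ) κ) m
  ... | inj₁ mr = here (∈-replicate⁻ (d κ) mr)
  ... | inj₂ mc = there (∈-copies⁻ d E z mc)

  length-copies≤ : ∀ d E b → (∀ κ → d κ ≤ b) → length (copies d E) ≤ length E * b
  length-copies≤ d [] b f = z≤n
  length-copies≤ d (κ ∷ E) b f = begin
    length (replicate (d κ) κ ++ copies d E)         ≡⟨ length-++ (replicate (d κ) κ) ⟩
    length (replicate (d κ) κ) + length (copies d E) ≡⟨ cong (_+ length (copies d E)) (length-replicate (d κ)) ⟩
    d κ + length (copies d E)                        ≤⟨ +-mono-≤ (f κ) (length-copies≤ d E b f) ⟩
    b + length E * b                                 ∎
    where open ≤-Reasoning

  multiplicity-copies : ∀ d E → Unique E → ∀ κ → κ ∈L E → multiplicity κ (copies d E) ≡ d κ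
  multiplicity-copies d (κ′ ∷ E) (u ∷ us) κ m = trans (count-++ _ (replicate (d κ′) κ′) (copies d E)) (go m)
    where
      go : κ ∈L κ′ ∷ E → multiplicity κ (replicate (d κ′) κ′) + multiplicity κ (copies d E) ≡ d κ
      go (here refl) = trans (cong₂ _+_ (count-replicate-yes _ (d κ) refl)
                                        (count≡0 _ (copies d E) (λ z mz e → All.lookup u (∈-copies⁻ d E z mz) (sym e))))
                             (+-identityʳ _)
      go (there m′) = trans (cong (_+ multiplicity κ (copies d E)) (count-replicate-no _ (d κ′) (All.lookup u m′)))
                            (multiplicity-copies d E us κ m′)

  -- Truncating every multiplicity at T′ + 1 and padding with a key that
  -- occurs more than T′ times keeps all multiplicities equal up to T′.
  module Rebalance (default : K) (T′ : ℕ) (E : List K) (xs : List K) where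

    truncated : List K
    truncated = copies (λ κ → multiplicity κ xs ⊓ suc T′) E

    abundant? : ∀ κ → Dec (T′ < multiplicity κ xs)
    abundant? κ = T′ <? multiplicity κ xs

    abundantKey : K
    abundantKey = findOr default abundant? E

    padded : ℕ → List K
    padded b = truncated ++ replicate (b ∸ length truncated) abundantKey

    rebalance : ℕ → List K
    rebalance b with length xs ≟ b
    ... | yes _ = xs
    ... | no _  = padded b

    module Padding (T b : ℕ) (uE : Unique E) (xs⊆E : ∀ z → z ∈L xs → z ∈L E) (bound : length E * suc T′ ≤ suc T)
             (T<xs : T < length xs) (T<b : T < b) where

      -- Otherwise T < length xs ≤ |E| T′, contradicting |E| (T′ + 1) ≤ T + 1.
      some-abundant : ∃ λ κ → κ ∈L E × T′ < multiplicity κ xs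
      some-abundant with 0 <? count abundant? E
      ... | yes pos = count>0⇒∃ abundant? E pos
      ... | no npos = ⊥-elim (n≮0 (≤-trans T<xs (≤-trans xs≤ (≤-reflexive (cong (_* T′) (n≤0⇒n≡0 E≤0))))))
        where
          xs≤ : length xs ≤ length E * T′
          xs≤ = length≤ E xs T′ xs⊆E (λ κ m → ≮⇒≥ (λ lt → npos (count>0 abundant? E m lt)))
          E≤0 : length E ≤ 0
          E≤0 = +-cancelʳ-≤ (length E * T′) (length E) 0
                  (≤-trans (≤-reflexive (sym (*-suc (length E) T′))) (≤-trans bound (≤-trans T<xs xs≤)))

      abundantKey-spec : abundantKey ∈L E × T′ < multiplicity abundantKey xs
      abundantKey-spec = let (κ , m , a) = some-abundant in findOr-spec default abundant? E m a

      length-padded : length (padded b) ≡ b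
      length-padded = trans (length-++ truncated)
        (trans (cong (length truncated +_) (length-replicate (b ∸ length truncated))) (m+[n∸m]≡n truncated≤b))
        where
          truncated≤b : length truncated ≤ b
          truncated≤b = ≤-trans (length-copies≤ _ E (suc T′) (λ κ → m⊓n≤n _ _)) (≤-trans bound T<b)

      padded⊆E : ∀ z → z ∈L padded b → z ∈L E
      padded⊆E z m with ∈-++⁻ truncated m
      ... | inj₁ mt = ∈-copies⁻ _ E z mt
      ... | inj₂ mp = subst (_∈L E) (sym (∈-replicate⁻ (b ∸ length truncated) mp)) (proj₁ abundantKey-spec)

      multiplicity-padded : ∀ κ → κ ∈L E → multiplicity κ xs ≈[ T′ ] multiplicity κ (padded b)
      multiplicity-padded κ m
        rewrite count-++ (_≟K κ) truncated (replicate (b ∸ length truncated) abundantKey)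
              | multiplicity-copies (λ κ → multiplicity κ xs ⊓ suc T′) E uE κ m
        with abundantKey ≟K κ
      ... | yes refl = inj₂ (proj₂ abundantKey-spec ,
                             ≤-trans (≤-reflexive (sym (m≥n⇒m⊓n≡n (proj₂ abundantKey-spec)))) (m≤m+n _ _))
      ... | no ne rewrite count-replicate-no (_≟K κ) (b ∸ length truncated) ne
                        | +-identityʳ (multiplicity κ xs ⊓ suc T′) = truncation-≈ (multiplicity κ xs)
        where
          truncation-≈ : ∀ c → c ≈[ T′ ] c ⊓ suc T′
          truncation-≈ c with c ≤? T′
          ... | yes le = inj₁ (sym (m≤n⇒m⊓n≡m (m≤n⇒m≤1+n le)))
          ... | no nle = inj₂ (≰⇒> nle , subst (T′ <_) (sym (m≥n⇒m⊓n≡n (≰⇒> nle))) ≤-refl)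

    rebalance-spec : ∀ T b → Unique E → (∀ z → z ∈L xs → z ∈L E) → length E * suc T′ ≤ suc T →
                     length xs ≈[ T ] b →
                     length (rebalance b) ≡ b × (∀ z → z ∈L rebalance b → z ∈L E) ×
                     (∀ κ → κ ∈L E → multiplicity κ xs ≈[ T′ ] multiplicity κ (rebalance b))
    rebalance-spec T b uE xs⊆E bound xs≈b with length xs ≟ b
    ... | yes e = e , xs⊆E , λ _ _ → inj₁ refl
    ... | no ne with xs≈b
    ...   | inj₁ e          = ⊥-elim (ne e)
    ...   | inj₂ (T<xs , T<b) = length-padded , padded⊆E , multiplicity-padded
      where open Padding T b uE xs⊆E bound T<xs T<b

subsetsOf : ∀ {n} → Subset n → List (Subset n)
subsetsOf []          = [] ∷ []
subsetsOf (true ∷ R)  = map (inside ∷_) (subsetsOf R) ++ map (outside ∷_) (subsetsOf R)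
subsetsOf (false ∷ R) = map (outside ∷_) (subsetsOf R)

length-subsetsOf : ∀ {n} (R : Subset n) → length (subsetsOf R) ≡ 2 ^ ∣ R ∣
length-subsetsOf [] = refl
length-subsetsOf (true ∷ R) = begin
  length (map (inside ∷_) (subsetsOf R) ++ map (outside ∷_) (subsetsOf R))   ≡⟨ length-++ (map (inside ∷_) (subsetsOf R)) ⟩
  length (map (inside ∷_) (subsetsOf R)) + length (map (outside ∷_) (subsetsOf R))
    ≡⟨ cong₂ _+_ (length-map (inside ∷_) (subsetsOf R)) (length-map (outside ∷_) (subsetsOf R)) ⟩
  length (subsetsOf R) + length (subsetsOf R)                                ≡⟨ cong₂ _+_ (length-subsetsOf R) (length-subsetsOf R) ⟩
  2 ^ ∣ R ∣ + 2 ^ ∣ R ∣                                                      ≡⟨ cong (2 ^ ∣ R ∣ +_) (sym (+-identityʳ _)) ⟩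
  2 ^ suc ∣ R ∣                                                              ∎
  where open ≡-Reasoning
length-subsetsOf (false ∷ R) = trans (length-map (outside ∷_) (subsetsOf R)) (length-subsetsOf R)

subsetsOf-unique : ∀ {n} (R : Subset n) → Unique (subsetsOf R)
subsetsOf-unique [] = All.[] ∷ []
subsetsOf-unique (true ∷ R) =
  Unique.++⁺ (Unique.map⁺ Vec.∷-injectiveʳ (subsetsOf-unique R)) (Unique.map⁺ Vec.∷-injectiveʳ (subsetsOf-unique R)) disjoint
  where
    disjoint : ∀ {v} → ¬ (v ∈L map (inside ∷_) (subsetsOf R) × v ∈L map (outside ∷_) (subsetsOf R))
    disjoint (m₁ , m₂) with ∈-map⁻ (inside ∷_) m₁ | ∈-map⁻ (outside ∷_) m₂
    ... | _ , _ , refl | _ , _ , ()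
subsetsOf-unique (false ∷ R) = Unique.map⁺ Vec.∷-injectiveʳ (subsetsOf-unique R)

∈-subsetsOf⁺ : ∀ {n} (R κ : Subset n) → κ ⊆ R → κ ∈L subsetsOf R
∈-subsetsOf⁺ [] [] _ = here refl
∈-subsetsOf⁺ (true ∷ R) (true ∷ κ) s = ∈-++⁺ˡ (∈-map⁺ (inside ∷_) (∈-subsetsOf⁺ R κ (drop-∷-⊆ s)))
∈-subsetsOf⁺ (true ∷ R) (false ∷ κ) s =
  ∈-++⁺ʳ (map (inside ∷_) (subsetsOf R)) (∈-map⁺ (outside ∷_) (∈-subsetsOf⁺ R κ (drop-∷-⊆ s)))
∈-subsetsOf⁺ (false ∷ R) (true ∷ κ) s with s Data.Vec.here
... | ()
∈-subsetsOf⁺ (false ∷ R) (false ∷ κ) s = ∈-map⁺ (outside ∷_) (∈-subsetsOf⁺ R κ (drop-∷-⊆ s))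

∈-subsetsOf⁻ : ∀ {n} (R κ : Subset n) → κ ∈L subsetsOf R → κ ⊆ R
∈-subsetsOf⁻ [] [] _ = λ ()
∈-subsetsOf⁻ (true ∷ R) κ m with ∈-++⁻ (map (inside ∷_) (subsetsOf R)) m
... | inj₁ m₁ with ∈-map⁻ (inside ∷_) m₁
...   | κ′ , m′ , refl = s⊆s (∈-subsetsOf⁻ R κ′ m′)
∈-subsetsOf⁻ (true ∷ R) κ m | inj₂ m₂ with ∈-map⁻ (outside ∷_) m₂
...   | κ′ , m′ , refl = out⊆ (∈-subsetsOf⁻ R κ′ m′)
∈-subsetsOf⁻ (false ∷ R) κ m with ∈-map⁻ (outside ∷_) m
... | κ′ , m′ , refl = out⊆ (∈-subsetsOf⁻ R κ′ m′)

module Pairing {A K : Set} (_≟_ : DecidableEquality A) (default : K) where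

  keyOf : List A → List K → A → K
  keyOf []       _        _ = default
  keyOf (_ ∷ _)  []       _ = default
  keyOf (x ∷ xs) (κ ∷ κs) y with x ≟ y
  ... | yes _ = κ
  ... | no _  = keyOf xs κs y

  map-keyOf : ∀ xs κs → Unique xs → length κs ≡ length xs → map (keyOf xs κs) xs ≡ κs
  map-keyOf [] [] _ _ = refl
  map-keyOf (x ∷ xs) (κ ∷ κs) (u ∷ us) e with x ≟ x
  ... | no x≢x = ⊥-elim (x≢x refl)
  ... | yes _  = cong (κ ∷_) (trans (map-cong-∈ xs skip) (map-keyOf xs κs us (suc-injective e)))
    where
      map-cong-∈ : ∀ ys {f g : A → K} → (∀ y → y ∈L ys → f y ≡ g y) → map f ys ≡ map g ys
      map-cong-∈ []       h = refl
      map-cong-∈ (y ∷ ys) h = cong₂ _∷_ (h y (here refl)) (map-cong-∈ ys (λ z m → h z (there m)))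
      skip : ∀ y → y ∈L xs → keyOf (x ∷ xs) (κ ∷ κs) y ≡ keyOf xs κs y
      skip y m with x ≟ y
      ... | yes x≡y = ⊥-elim (All.lookup u m x≡y)
      ... | no _    = refl

  keyOf-∈ : ∀ xs κs y → keyOf xs κs y ∈L κs ⊎ keyOf xs κs y ≡ default
  keyOf-∈ []       _        _ = inj₂ refl
  keyOf-∈ (_ ∷ _)  []       _ = inj₂ refl
  keyOf-∈ (x ∷ xs) (κ ∷ κs) y with x ≟ y
  ... | yes _ = inj₁ (here refl)
  ... | no _  = Sum.map₁ there (keyOf-∈ xs κs y)

-- Connected components of G - S

module Components {n} (G : Graph n) (S : Subset n) where

  reach-source : ∀ {u v} → Reach G S u v → u ∉ S
  reach-source (here u∉S)   = u∉S
  reach-source (step r _ _) = reach-source r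

  reach-target : ∀ {u v} → Reach G S u v → v ∉ S
  reach-target (here u∉S)     = u∉S
  reach-target (step _ _ v∉S) = v∉S

  reach-trans : ∀ {u w v} → Reach G S u w → Reach G S w v → Reach G S u v
  reach-trans r (here _)        = r
  reach-trans r (step r′ a v∉S) = step (reach-trans r r′) a v∉S

  reach-sym : ∀ {u v} → Reach G S u v → Reach G S v u
  reach-sym (here u∉S) = here u∉S
  reach-sym {u} {v} (step {w} r a v∉S) =
    reach-trans (step (here v∉S) (trans (Graph.sym G v w) a) (reach-target r)) (reach-sym r)

  -- A component is computed as the fixed point of repeatedly adding the
  -- neighbours outside S; n rounds suffice because every round that is not
  -- a fixed point adds a vertex.
  neighbour? : (R : Subset n) → ∀ v → Dec (v ∉ S × ∃ λ u → u ∈ R × adj G u v ≡ true)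
  neighbour? R v = ¬? (v ∈? S) ×-dec Fin.any? (λ u → (u ∈? R) ×-dec (adj G u v Bool.≟ true))

  expand : Subset n → Subset n
  expand R = R ∪ subsetOf (neighbour? R)

  expand^ : ℕ → Subset n → Subset n
  expand^ zero    R = R
  expand^ (suc j) R = expand^ j (expand R)

  Closed : Subset n → Set
  Closed R = expand R ≡ R

  ⊆-expand : ∀ R → R ⊆ expand R
  ⊆-expand R = p⊆p∪q {p = R} _

  ⊆-expand^ : ∀ j R → R ⊆ expand^ j R
  ⊆-expand^ zero    R m = m
  ⊆-expand^ (suc j) R m = ⊆-expand^ j (expand R) (⊆-expand R m)

  expand^-closed : ∀ j R → Closed R → expand^ j R ≡ R
  expand^-closed zero    R c = refl
  expand^-closed (suc j) R c rewrite c = expand^-closed j R c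

  expand^-closed-or-grows : ∀ j R → Closed (expand^ j R) ⊎ ∣ R ∣ + j ≤ ∣ expand^ j R ∣
  expand^-closed-or-grows zero R = inj₂ (≤-reflexive (+-identityʳ _))
  expand^-closed-or-grows (suc j) R with expand R ≟ₛ R
  ... | yes c rewrite c | expand^-closed j R c = inj₁ c
  ... | no ¬c with Fin.any? (λ x → (x ∈? expand R) ×-dec ¬? (x ∈? R))
  ...   | no ¬new = ⊥-elim (¬c (subset-ext old (λ v → ⊆-expand R)))
    where
      old : ∀ v → v ∈ expand R → v ∈ R
      old v m with v ∈? R
      ... | yes r  = r
      ... | no ¬r = ⊥-elim (¬new (v , m , ¬r))
  ...   | yes (x , x∈ , x∉) with expand^-closed-or-grows j (expand R)
  ...     | inj₁ c  = inj₁ c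
  ...     | inj₂ le = inj₂ (≤-trans (≤-reflexive (+-suc ∣ R ∣ j))
                          (≤-trans (+-monoˡ-≤ j (p⊂q⇒∣p∣<∣q∣ ((λ {y} → ⊆-expand R {y}) , x , x∈ , x∉))) le))

  closed-reach : ∀ {R u v} → Closed R → u ∈ R → Reach G S u v → v ∈ R
  closed-reach c m (here _) = m
  closed-reach {R} c m (step {w} {v} r a v∉S) =
    subst (v ∈_) c (x∈p∪q⁺ (inj₂ (∈-subsetOf⁺ (neighbour? R) (v∉S , w , closed-reach c m r , a))))

  expand^-reach : ∀ {w} j R → (∀ u → u ∈ R → Reach G S w u) → ∀ v → v ∈ expand^ j R → Reach G S w v
  expand^-reach zero    R f v m = f v m
  expand^-reach {w} (suc j) R f v m = expand^-reach j (expand R) g v m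
    where
      g : ∀ u → u ∈ expand R → Reach G S w u
      g u mu with x∈p∪q⁻ R _ mu
      ... | inj₁ r = f u r
      ... | inj₂ nb with ∈-subsetOf⁻ (neighbour? R) nb
      ...   | u∉S , u′ , m′ , a = step (f u′ m′) a u∉S

  seed? : (w : Fin n) → ∀ v → Dec (v ≡ w × w ∉ S)
  seed? w v = (v Fin.≟ w) ×-dec ¬? (w ∈? S)

  componentOf : Fin n → Subset n
  componentOf w = expand^ n (subsetOf (seed? w))

  ∈-componentOf : ∀ {w} → w ∉ S → w ∈ componentOf w
  ∈-componentOf {w} w∉S = ⊆-expand^ n _ (∈-subsetOf⁺ (seed? w) (refl , w∉S))

  componentOf-closed : ∀ {w} → w ∉ S → Closed (componentOf w)
  componentOf-closed {w} w∉S with expand^-closed-or-grows n (subsetOf (seed? w))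
  ... | inj₁ c  = c
  ... | inj₂ le = ⊥-elim (<-irrefl refl (≤-trans (+-monoˡ-≤ n seed-size) (≤-trans le (∣p∣≤n (componentOf w)))))
    where
      seed-size : 1 ≤ ∣ subsetOf (seed? w) ∣
      seed-size = ≤-<-trans z≤n (x∈p⇒∣p-x∣<∣p∣ (∈-subsetOf⁺ (seed? w) (refl , w∉S)))

  componentOf⇔reach : ∀ {w v} → w ∉ S → (v ∈ componentOf w ⇔ Reach G S w v)
  componentOf⇔reach {w} {v} w∉S =
    mk⇔ (expand^-reach n _ seed-reach v) (closed-reach (componentOf-closed w∉S) (∈-componentOf w∉S))
    where
      seed-reach : ∀ u → u ∈ subsetOf (seed? w) → Reach G S w u
      seed-reach u m with ∈-subsetOf⁻ (seed? w) m
      ... | refl , _ = here w∉S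

  componentOf-∈ : ∀ {w u} → w ∉ S → u ∈ componentOf w → componentOf u ≡ componentOf w
  componentOf-∈ {w} {u} w∉S m = subset-ext
    (λ v mv → from (componentOf⇔reach w∉S) (reach-trans r (to (componentOf⇔reach (reach-target r)) mv)))
    (λ v mv → from (componentOf⇔reach (reach-target r)) (reach-trans (reach-sym r) (to (componentOf⇔reach w∉S) mv)))
    where r = to (componentOf⇔reach w∉S) m

  components : List (Subset n)
  components = deduplicate _≟ₛ_ (map componentOf (filter (λ v → ¬? (v ∈? S)) (allFin n)))

  components-unique : Unique components
  components-unique = UniqueDec.deduplicate-! _≟ₛ_ _

  componentOf∈components : ∀ {w} → w ∉ S → componentOf w ∈L components
  componentOf∈components w∉S = ∈-deduplicate⁺ _≟ₛ_ (∈-map⁺ componentOf (∈-filter⁺ (λ v → ¬? (v ∈? S)) (∈-allFin _) w∉S))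

  ∈components⇒≡componentOf : ∀ {B} → B ∈L components → ∃ λ w → w ∉ S × B ≡ componentOf w
  ∈components⇒≡componentOf m with ∈-map⁻ componentOf (∈-deduplicate⁻ _≟ₛ_ _ m)
  ... | w , mf , e = w , proj₂ (∈-filter⁻ (λ v → ¬? (v ∈? S)) {xs = allFin n} mf) , e

  module _ {B} (B∈ : B ∈L components) where

    component-∉S : ∀ {w} → w ∈ B → w ∉ S
    component-∉S m with ∈components⇒≡componentOf B∈
    ... | w₀ , w₀∉S , refl = reach-target (to (componentOf⇔reach w₀∉S) m)

    componentOf-member : ∀ {w} → w ∈ B → componentOf w ≡ B
    componentOf-member m with ∈components⇒≡componentOf B∈
    ... | w₀ , w₀∉S , refl = componentOf-∈ w₀∉S m

    component-nonempty : ∃ λ w → w ∈ B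
    component-nonempty with ∈components⇒≡componentOf B∈
    ... | w₀ , w₀∉S , refl = w₀ , ∈-componentOf w₀∉S

    component-no-edge-out : ∀ {u v} → u ∈ B → v ∉ S → v ∉ B → adj G u v ≡ false
    component-no-edge-out {u} {v} mu v∉S v∉B with adj G u v in e
    ... | false = refl
    ... | true with ∈components⇒≡componentOf B∈
    ...   | w₀ , w₀∉S , refl =
            ⊥-elim (v∉B (from (componentOf⇔reach w₀∉S) (step (to (componentOf⇔reach w₀∉S) mu) e v∉S)))

  ∈components⇔IsComponent : ∀ B → (B ∈L components ⇔ IsComponent G S B)
  ∈components⇔IsComponent B = mk⇔ sound complete
    where
      sound : B ∈L components → IsComponent G S B
      sound m with ∈components⇒≡componentOf m
      ... | w₀ , w₀∉S , refl = (w₀ , ∈-componentOf w₀∉S) , λ u v mu →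
            mk⇔ (λ mv → reach-trans (reach-sym (to (componentOf⇔reach w₀∉S) mu)) (to (componentOf⇔reach w₀∉S) mv))
                (λ r → from (componentOf⇔reach w₀∉S) (reach-trans (to (componentOf⇔reach w₀∉S) mu) r))
      complete : IsComponent G S B → B ∈L components
      complete ((u , mu) , h) = subst (_∈L components) (sym B≡) (componentOf∈components u∉S)
        where
          u∉S = reach-source (to (h u u mu) mu)
          B≡ : B ≡ componentOf u
          B≡ = subset-ext (λ v mv → from (componentOf⇔reach u∉S) (to (h u v mu) mv))
                          (λ v mv → from (h u v mu) (to (componentOf⇔reach u∉S) mv))

-- Types of components

module Types {n p} (G : Graph n) (C : Colors n p) (S : Subset n) where

  infix 4 _∈S∪_
  _∈S∪_ : Fin n → Subset n → Set
  w ∈S∪ B = w ∈ S ⊎ w ∈ B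

  _∈S∪?_ : ∀ w B → Dec (w ∈S∪ B)
  w ∈S∪? B = (w ∈? S) ⊎-dec (w ∈? B)

  -- ψ : S ∪ B → S ∪ A as in SameType, which in addition carries the set
  -- variables X to X′ and the vertex variables of ρ lying in S ∪ B to ρ′.
  record IsIso {s v} (ψ ψ⁻ : Fin n → Fin n) (B : Subset n) (X : Fin s → Subset n) (ρ : Fin v → Fin n)
               (A : Subset n) (X′ : Fin s → Subset n) (ρ′ : Fin v → Fin n) : Set where
    field
      maps-to       : ∀ w → w ∈S∪ B → ψ w ∈S∪ A
      inverseˡ      : ∀ w → w ∈S∪ B → ψ⁻ (ψ w) ≡ w
      maps-from     : ∀ w → w ∈S∪ A → ψ⁻ w ∈S∪ B
      inverseʳ      : ∀ w → w ∈S∪ A → ψ (ψ⁻ w) ≡ w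
      fixes-S       : ∀ w → w ∈ S → ψ w ≡ w
      preserves-adj : ∀ u w → u ∈S∪ B → w ∈S∪ B → adj G u w ≡ adj G (ψ u) (ψ w)
      preserves-col : ∀ w → w ∈S∪ B → ∀ i → (w ∈ C i ⇔ ψ w ∈ C i)
      preserves-set : ∀ w → w ∈S∪ B → ∀ j → (w ∈ X j ⇔ ψ w ∈ X′ j)
      preserves-var : ∀ w → w ∈S∪ B → ∀ x → (ρ x ≡ w ⇔ ρ′ x ≡ ψ w)

  Iso : ∀ {s v} (B : Subset n) (X : Fin s → Subset n) (ρ : Fin v → Fin n)
        (A : Subset n) (X′ : Fin s → Subset n) (ρ′ : Fin v → Fin n) → Set
  Iso B X ρ A X′ ρ′ = Σ (Fin n → Fin n) λ ψ → Σ (Fin n → Fin n) λ ψ⁻ → IsIso ψ ψ⁻ B X ρ A X′ ρ′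

  module _ {s v} {B : Subset n} {X : Fin s → Subset n} {ρ : Fin v → Fin n}
           {A : Subset n} {X′ : Fin s → Subset n} {ρ′ : Fin v → Fin n} where

    isIso? : ∀ ψ ψ⁻ → Dec (IsIso ψ ψ⁻ B X ρ A X′ ρ′)
    isIso? ψ ψ⁻ = map′
      (λ (a , b , c , d , e , f , g , h , i) → record
         { maps-to = a ; inverseˡ = b ; maps-from = c ; inverseʳ = d ; fixes-S = e
         ; preserves-adj = f ; preserves-col = g ; preserves-set = h ; preserves-var = i })
      (λ r → let open IsIso r in
         maps-to , inverseˡ , maps-from , inverseʳ , fixes-S , preserves-adj , preserves-col , preserves-set , preserves-var)
      (Fin.all? (λ w → (w ∈S∪? B) →-dec (ψ w ∈S∪? A)) ×-dec
       Fin.all? (λ w → (w ∈S∪? B) →-dec (ψ⁻ (ψ w) Fin.≟ w)) ×-dec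
       Fin.all? (λ w → (w ∈S∪? A) →-dec (ψ⁻ w ∈S∪? B)) ×-dec
       Fin.all? (λ w → (w ∈S∪? A) →-dec (ψ (ψ⁻ w) Fin.≟ w)) ×-dec
       Fin.all? (λ w → (w ∈? S) →-dec (ψ w Fin.≟ w)) ×-dec
       Fin.all? (λ u → Fin.all? (λ w → (u ∈S∪? B) →-dec ((w ∈S∪? B) →-dec (adj G u w Bool.≟ adj G (ψ u) (ψ w))))) ×-dec
       Fin.all? (λ w → (w ∈S∪? B) →-dec Fin.all? (λ i → (w ∈? C i) ⇔-dec (ψ w ∈? C i))) ×-dec
       Fin.all? (λ w → (w ∈S∪? B) →-dec Fin.all? (λ j → (w ∈? X j) ⇔-dec (ψ w ∈? X′ j))) ×-dec
       Fin.all? (λ w → (w ∈S∪? B) →-dec Fin.all? (λ x → (ρ x Fin.≟ w) ⇔-dec (ρ′ x Fin.≟ ψ w))))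

    isIso-resp : ∀ {ψ₁ ψ₂ ψ⁻₁ ψ⁻₂} → (∀ w → ψ₁ w ≡ ψ₂ w) → (∀ w → ψ⁻₁ w ≡ ψ⁻₂ w) →
                 IsIso ψ₁ ψ⁻₁ B X ρ A X′ ρ′ → IsIso ψ₂ ψ⁻₂ B X ρ A X′ ρ′
    isIso-resp {ψ₁} {ψ₂} {ψ⁻₁} {ψ⁻₂} e e⁻ r = record
      { maps-to       = λ w m → subst (_∈S∪ A) (e w) (maps-to w m)
      ; inverseˡ      = λ w m → trans (sym (trans (e⁻ (ψ₁ w)) (cong ψ⁻₂ (e w)))) (inverseˡ w m)
      ; maps-from     = λ w m → subst (_∈S∪ B) (e⁻ w) (maps-from w m)
      ; inverseʳ      = λ w m → trans (sym (trans (e (ψ⁻₁ w)) (cong ψ₂ (e⁻ w)))) (inverseʳ w m)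
      ; fixes-S       = λ w m → trans (sym (e w)) (fixes-S w m)
      ; preserves-adj = λ u w mu mw → trans (preserves-adj u w mu mw) (cong₂ (adj G) (e u) (e w))
      ; preserves-col = λ w m i → ⇔.trans (preserves-col w m i) (⇔-subst (_∈ C i) (e w))
      ; preserves-set = λ w m j → ⇔.trans (preserves-set w m j) (⇔-subst (_∈ X′ j) (e w))
      ; preserves-var = λ w m x → ⇔.trans (preserves-var w m x) (⇔-subst (ρ′ x ≡_) (e w))
      }
      where open IsIso r

    iso? : Dec (Iso B X ρ A X′ ρ′)
    iso? = ∃-function? n _ (λ f g e (ψ⁻ , r) → ψ⁻ , isIso-resp e (λ _ → refl) r)
             (λ ψ → ∃-function? n _ (λ f g e → isIso-resp (λ _ → refl) e) (isIso? ψ))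

    fixes-S⁻ : ∀ {ψ ψ⁻} → IsIso ψ ψ⁻ B X ρ A X′ ρ′ → ∀ w → w ∈ S → ψ⁻ w ≡ w
    fixes-S⁻ {ψ⁻ = ψ⁻} r w m = trans (cong ψ⁻ (sym (IsIso.fixes-S r w m))) (IsIso.inverseˡ r w (inj₁ m))

  iso-refl : ∀ {s v} B (X : Fin s → Subset n) (ρ : Fin v → Fin n) → Iso B X ρ B X ρ
  iso-refl B X ρ = (λ w → w) , (λ w → w) , record
    { maps-to = λ _ m → m ; inverseˡ = λ _ _ → refl ; maps-from = λ _ m → m ; inverseʳ = λ _ _ → refl
    ; fixes-S = λ _ _ → refl ; preserves-adj = λ _ _ _ _ → refl ; preserves-col = λ _ _ _ → ⇔.refl
    ; preserves-set = λ _ _ _ → ⇔.refl ; preserves-var = λ _ _ _ → ⇔.refl }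

  iso-sym : ∀ {s v} {B A} {X X′ : Fin s → Subset n} {ρ ρ′ : Fin v → Fin n} →
            Iso B X ρ A X′ ρ′ → Iso A X′ ρ′ B X ρ
  iso-sym {X′ = X′} {ρ′ = ρ′} (ψ , ψ⁻ , r) = ψ⁻ , ψ , record
    { maps-to = maps-from ; inverseˡ = inverseʳ ; maps-from = maps-to ; inverseʳ = inverseˡ
    ; fixes-S = fixes-S⁻ r
    ; preserves-adj = λ u w mu mw → trans (sym (cong₂ (adj G) (inverseʳ u mu) (inverseʳ w mw)))
                                          (sym (preserves-adj (ψ⁻ u) (ψ⁻ w) (maps-from u mu) (maps-from w mw)))
    ; preserves-col = λ w m i → ⇔.sym (⇔.trans (preserves-col (ψ⁻ w) (maps-from w m) i) (⇔-subst (_∈ C i) (inverseʳ w m)))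
    ; preserves-set = λ w m j → ⇔.sym (⇔.trans (preserves-set (ψ⁻ w) (maps-from w m) j) (⇔-subst (_∈ X′ j) (inverseʳ w m)))
    ; preserves-var = λ w m x → ⇔.sym (⇔.trans (preserves-var (ψ⁻ w) (maps-from w m) x) (⇔-subst (ρ′ x ≡_) (inverseʳ w m)))
    }
    where open IsIso r

  iso-trans : ∀ {s v} {B₁ B₂ B₃} {X₁ X₂ X₃ : Fin s → Subset n} {ρ₁ ρ₂ ρ₃ : Fin v → Fin n} →
              Iso B₁ X₁ ρ₁ B₂ X₂ ρ₂ → Iso B₂ X₂ ρ₂ B₃ X₃ ρ₃ → Iso B₁ X₁ ρ₁ B₃ X₃ ρ₃
  iso-trans (ψ , ψ⁻ , r) (φ , φ⁻ , t) = (λ w → φ (ψ w)) , (λ w → ψ⁻ (φ⁻ w)) , record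
    { maps-to       = λ w m → T.maps-to (ψ w) (R.maps-to w m)
    ; inverseˡ      = λ w m → trans (cong ψ⁻ (T.inverseˡ (ψ w) (R.maps-to w m))) (R.inverseˡ w m)
    ; maps-from     = λ w m → R.maps-from (φ⁻ w) (T.maps-from w m)
    ; inverseʳ      = λ w m → trans (cong φ (R.inverseʳ (φ⁻ w) (T.maps-from w m))) (T.inverseʳ w m)
    ; fixes-S       = λ w m → trans (cong φ (R.fixes-S w m)) (T.fixes-S w m)
    ; preserves-adj = λ u w mu mw → trans (R.preserves-adj u w mu mw) (T.preserves-adj (ψ u) (ψ w) (R.maps-to u mu) (R.maps-to w mw))
    ; preserves-col = λ w m i → ⇔.trans (R.preserves-col w m i) (T.preserves-col (ψ w) (R.maps-to w m) i)
    ; preserves-set = λ w m j → ⇔.trans (R.preserves-set w m j) (T.preserves-set (ψ w) (R.maps-to w m) j)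
    ; preserves-var = λ w m x → ⇔.trans (R.preserves-var w m x) (T.preserves-var (ψ w) (R.maps-to w m) x)
    }
    where module R = IsIso r
          module T = IsIso t

  iso-subst-source : ∀ {s v} {B B′ A} {X X′ : Fin s → Subset n} {ρ ρ′ : Fin v → Fin n} →
                     B ≡ B′ → Iso B X ρ A X′ ρ′ → Iso B′ X ρ A X′ ρ′
  iso-subst-source refl i = i

  module _ {s v} {B A : Subset n} {X Z : Fin s → Subset n} {ρ : Fin v → Fin n}
           {ρ′ : Fin (suc v) → Fin n} {c : Fin n} where

    dropVar : Iso B X (extendEnv c ρ) A Z ρ′ → Iso B X ρ A Z (λ x → ρ′ (suc x))
    dropVar (ψ , ψ⁻ , r) = ψ , ψ⁻ , record { IsIso r ; preserves-var = λ w m x → preserves-var w m (suc x) }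
      where open IsIso r

    addVar : ∀ {ψ ψ⁻} → IsIso ψ ψ⁻ B X ρ A Z (λ x → ρ′ (suc x)) → (∀ w → w ∈S∪ B → (c ≡ w ⇔ ρ′ zero ≡ ψ w)) →
             Iso B X (extendEnv c ρ) A Z ρ′
    addVar {ψ} {ψ⁻} r new = ψ , ψ⁻ , record
      { IsIso r ; preserves-var = λ { w m zero → new w m ; w m (suc x) → preserves-var w m x } }
      where open IsIso r

  module _ {s v} {B A : Subset n} {X : Fin s → Subset n} {Z : Fin (suc s) → Subset n}
           {ρ ρ′ : Fin v → Fin n} {U : Subset n} where

    dropSet : Iso B (extendEnv U X) ρ A Z ρ′ → Iso B X ρ A (λ j → Z (suc j)) ρ′
    dropSet (ψ , ψ⁻ , r) = ψ , ψ⁻ , record { IsIso r ; preserves-set = λ w m j → preserves-set w m (suc j) }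
      where open IsIso r

    addSet : ∀ {ψ ψ⁻} → IsIso ψ ψ⁻ B X ρ A (λ j → Z (suc j)) ρ′ → (∀ w → w ∈S∪ B → (w ∈ U ⇔ ψ w ∈ Z zero)) →
             Iso B (extendEnv U X) ρ A Z ρ′
    addSet {ψ} {ψ⁻} r new = ψ , ψ⁻ , record
      { IsIso r ; preserves-set = λ { w m zero → new w m ; w m (suc j) → preserves-set w m j } }
      where open IsIso r

  iso⇔SameType : ∀ {s} {B A : Subset n} {X Z : Fin s → Subset n} {ρ ρ′ : Fin 0 → Fin n} →
                 Iso B X ρ A Z ρ′ ⇔ SameType G S (extend C X) B (extend C Z) A
  iso⇔SameType {s} {B} {A} {X} {Z} = mk⇔ toSameType fromSameType
    where
      ∪⇒ : ∀ {D w} → w ∈ S ∪ D → w ∈S∪ D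
      ∪⇒ {D} = x∈p∪q⁻ S D
      ⇒∪ : ∀ {D w} → w ∈S∪ D → w ∈ S ∪ D
      ⇒∪ = x∈p∪q⁺
      toSameType : Iso B X _ A Z _ → SameType G S (extend C X) B (extend C Z) A
      toSameType (ψ , ψ⁻ , r) = ψ , ψ⁻ ,
          (λ v m → ⇒∪ (maps-to v (∪⇒ m)) , inverseˡ v (∪⇒ m)) ,
          (λ v m → ⇒∪ (maps-from v (∪⇒ m)) , inverseʳ v (∪⇒ m)) ,
          fixes-S ,
          (λ u v mu mv → preserves-adj u v (∪⇒ mu) (∪⇒ mv)) ,
          (λ v m i → colours v (∪⇒ m) (splitAt p i))
        where
          open IsIso r
          colours : ∀ v → v ∈S∪ B → ∀ e → (v ∈ [ C , X ]′ e ⇔ ψ v ∈ [ C , Z ]′ e)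
          colours v m (inj₁ i) = preserves-col v m i
          colours v m (inj₂ j) = preserves-set v m j
      fromSameType : SameType G S (extend C X) B (extend C Z) A → Iso B X _ A Z _
      fromSameType (ψ , ψ⁻ , f₁ , f₂ , f₃ , f₄ , f₅) = ψ , ψ⁻ , record
        { maps-to       = λ w m → ∪⇒ (proj₁ (f₁ w (⇒∪ m)))
        ; inverseˡ      = λ w m → proj₂ (f₁ w (⇒∪ m))
        ; maps-from     = λ w m → ∪⇒ (proj₁ (f₂ w (⇒∪ m)))
        ; inverseʳ      = λ w m → proj₂ (f₂ w (⇒∪ m))
        ; fixes-S       = f₃
        ; preserves-adj = λ u w mu mw → f₄ u w (⇒∪ mu) (⇒∪ mw)
        ; preserves-col = λ w m i → subst (λ t → w ∈ [ C , X ]′ t ⇔ ψ w ∈ [ C , Z ]′ t) (Fin.splitAt-↑ˡ p i s) (f₅ w (⇒∪ m) (i ↑ˡ s))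
        ; preserves-set = λ w m j → subst (λ t → w ∈ [ C , X ]′ t ⇔ ψ w ∈ [ C , Z ]′ t) (Fin.splitAt-↑ʳ p s j) (f₅ w (⇒∪ m) (p ↑ʳ j))
        ; preserves-var = λ w m ()
        }

-- The Ehrenfeucht–Fraïssé game

module Similarity {n p} (G : Graph n) (C : Colors n p) (S : Subset n) where

  open Components G S public
  open Types G C S public

  typeCount : ∀ {s v} (X : Fin s → Subset n) (ρ : Fin v → Fin n)
              (A : Subset n) (Z : Fin s → Subset n) (ρ′ : Fin v → Fin n) → ℕ
  typeCount X ρ A Z ρ′ = count (λ B → iso? {B = B} {X} {ρ} {A} {Z} {ρ′}) components

  -- The invariant of the game: equal S-shapes, for positions with vertex variables.
  record Similar {s v} (T : ℕ) (X₁ : Fin s → Subset n) (ρ₁ : Fin v → Fin n)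
                 (X₂ : Fin s → Subset n) (ρ₂ : Fin v → Fin n) : Set where
    constructor similar
    field
      sets-on-S   : ∀ w → w ∈ S → ∀ j → (w ∈ X₁ j ⇔ w ∈ X₂ j)
      vars-on-S   : ∀ w → w ∈ S → ∀ x → (ρ₁ x ≡ w ⇔ ρ₂ x ≡ w)
      type-counts : ∀ A → A ∈L components → ∀ (Z : Fin s → Subset n) (ρ′ : Fin v → Fin n) →
                    typeCount X₁ ρ₁ A Z ρ′ ≈[ T ] typeCount X₂ ρ₂ A Z ρ′
  open Similar public

  module _ {s v} {X₁ X₂ : Fin s → Subset n} {ρ₁ ρ₂ : Fin v → Fin n} where

    similar-sym : ∀ {T} → Similar T X₁ ρ₁ X₂ ρ₂ → Similar T X₂ ρ₂ X₁ ρ₁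
    similar-sym (similar a b c) =
      similar (λ w m j → ⇔.sym (a w m j)) (λ w m x → ⇔.sym (b w m x)) (λ A m Z ρ′ → ≈-sym (c A m Z ρ′))

    similar-mono : ∀ {T T′} → T′ ≤ T → Similar T X₁ ρ₁ X₂ ρ₂ → Similar T′ X₁ ρ₁ X₂ ρ₂
    similar-mono le (similar a b c) = similar a b (λ A m Z ρ′ → ≈-mono le (c A m Z ρ′))

    -- B is counted for its own type, so the other side has a component of that type too.
    partner : ∀ {T} → Similar T X₁ ρ₁ X₂ ρ₂ → ∀ {B} → B ∈L components →
              ∃ λ B′ → B′ ∈L components × Iso B X₁ ρ₁ B′ X₂ ρ₂
    partner sim {B} B∈ with count>0⇒∃ _ components
                              (≈-positive (type-counts sim B B∈ X₁ ρ₁) (count>0 _ components B∈ (iso-refl B X₁ ρ₁)))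
    ... | B′ , B′∈ , i = B′ , B′∈ , iso-sym i

  iso-maps-component : ∀ {s v} {B A} {X X′ : Fin s → Subset n} {ρ ρ′ : Fin v → Fin n} {ψ ψ⁻} →
                       B ∈L components → IsIso ψ ψ⁻ B X ρ A X′ ρ′ → ∀ w → w ∈ B → ψ w ∈ A
  iso-maps-component B∈ r w m with IsIso.maps-to r w (inj₂ m)
  ... | inj₂ x   = x
  ... | inj₁ ψw∈S = ⊥-elim (component-∉S B∈ m (subst (_∈ S) w≡ψw ψw∈S))
    where w≡ψw = trans (sym (fixes-S⁻ r _ ψw∈S)) (IsIso.inverseˡ r w (inj₂ m))

  module Atoms {s v} {X₁ X₂ : Fin s → Subset n} {ρ₁ ρ₂ : Fin v → Fin n} {T : ℕ}
               (sim : Similar T X₁ ρ₁ X₂ ρ₂) where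

    var-in-S : ∀ x → ρ₁ x ∈ S → ρ₂ x ≡ ρ₁ x
    var-in-S x m = to (vars-on-S sim (ρ₁ x) m x) refl

    var-in-component : ∀ x → ρ₁ x ∉ S →
      ∃ λ B′ → ∃ λ ψ → ∃ λ ψ⁻ → B′ ∈L components × IsIso ψ ψ⁻ (componentOf (ρ₁ x)) X₁ ρ₁ B′ X₂ ρ₂ × ρ₂ x ≡ ψ (ρ₁ x)
    var-in-component x x∉S with partner sim (componentOf∈components x∉S)
    ... | B′ , B′∈ , ψ , ψ⁻ , r = B′ , ψ , ψ⁻ , B′∈ , r , to (IsIso.preserves-var r _ (inj₂ (∈-componentOf x∉S)) x) refl

    adj-from-component : ∀ x y → ρ₁ x ∉ S → ρ₁ y ∈S∪ componentOf (ρ₁ x) →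
                         adj G (ρ₁ x) (ρ₁ y) ≡ adj G (ρ₂ x) (ρ₂ y)
    adj-from-component x y x∉S my with var-in-component x x∉S
    ... | _ , ψ , _ , _ , r , ex = trans (IsIso.preserves-adj r _ _ (inj₂ (∈-componentOf x∉S)) my)
                                         (cong₂ (adj G) (sym ex) (sym (to (IsIso.preserves-var r _ my y) refl)))

    adj-across-components : ∀ x y → ρ₁ x ∉ S → ρ₁ y ∉ S → ρ₁ y ∉ componentOf (ρ₁ x) →
                            adj G (ρ₁ x) (ρ₁ y) ≡ adj G (ρ₂ x) (ρ₂ y)
    adj-across-components x y x∉S y∉S y∉B with var-in-component x x∉S
    ... | B′ , ψ , ψ⁻ , B′∈ , r , ex =
      trans (component-no-edge-out (componentOf∈components x∉S) (∈-componentOf x∉S) y∉S y∉B)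
            (sym (component-no-edge-out B′∈ x₂∈B′ y₂∉S y₂∉B′))
      where
        open IsIso r
        x₂∈B′ : ρ₂ x ∈ B′
        x₂∈B′ = subst (_∈ B′) (sym ex) (iso-maps-component (componentOf∈components x∉S) r _ (∈-componentOf x∉S))
        y₂∉S : ρ₂ y ∉ S
        y₂∉S m = y∉S (subst (_∈ S) (sym (from (vars-on-S sim (ρ₂ y) m y) refl)) m)
        y₂∉B′ : ρ₂ y ∉ B′
        y₂∉B′ m = [ (λ w∈S → y∉S (subst (_∈ S) (sym y≡) w∈S)) , (λ w∈B → y∉B (subst (_∈ _) (sym y≡) w∈B)) ]′
                    (maps-from _ (inj₂ m))
          where
            y≡ : ρ₁ y ≡ ψ⁻ (ρ₂ y)
            y≡ = from (preserves-var (ψ⁻ (ρ₂ y)) (maps-from _ (inj₂ m)) y) (sym (inverseʳ _ (inj₂ m)))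

    adj-preserved : ∀ x y → adj G (ρ₁ x) (ρ₁ y) ≡ adj G (ρ₂ x) (ρ₂ y)
    adj-preserved x y with ρ₁ x ∈? S | ρ₁ y ∈? S
    ... | yes x∈S | yes y∈S = cong₂ (adj G) (sym (var-in-S x x∈S)) (sym (var-in-S y y∈S))
    ... | yes x∈S | no y∉S  = trans (Graph.sym G _ _)
                                (trans (adj-from-component y x y∉S (inj₁ x∈S)) (Graph.sym G _ _))
    ... | no x∉S  | yes y∈S = adj-from-component x y x∉S (inj₁ y∈S)
    ... | no x∉S  | no y∉S with ρ₁ y ∈? componentOf (ρ₁ x)
    ...   | yes y∈B = adj-from-component x y x∉S (inj₂ y∈B)
    ...   | no y∉B  = adj-across-components x y x∉S y∉S y∉B

    ≡-preserved : ∀ x y → ρ₁ x ≡ ρ₁ y → ρ₂ x ≡ ρ₂ y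
    ≡-preserved x y e with ρ₁ x ∈? S
    ... | yes x∈S = trans (var-in-S x x∈S) (trans e (sym (var-in-S y (subst (_∈ S) e x∈S))))
    ... | no x∉S with var-in-component x x∉S
    ...   | _ , ψ , _ , _ , r , ex =
            trans ex (trans (cong ψ e) (sym (to (IsIso.preserves-var r _ (inj₂ y∈B) y) refl)))
      where y∈B = subst (_∈ componentOf (ρ₁ x)) e (∈-componentOf x∉S)

    ∈set-preserved : ∀ x j → ρ₁ x ∈ X₁ j → ρ₂ x ∈ X₂ j
    ∈set-preserved x j m with ρ₁ x ∈? S
    ... | yes x∈S = subst (_∈ X₂ j) (sym (var-in-S x x∈S)) (to (sets-on-S sim (ρ₁ x) x∈S j) m)
    ... | no x∉S with var-in-component x x∉S
    ...   | _ , _ , _ , _ , r , ex =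
            subst (_∈ X₂ j) (sym ex) (to (IsIso.preserves-set r _ (inj₂ (∈-componentOf x∉S)) j) m)

    ∈colour-preserved : ∀ x i → ρ₁ x ∈ C i → ρ₂ x ∈ C i
    ∈colour-preserved x i m with ρ₁ x ∈? S
    ... | yes x∈S = subst (_∈ C i) (sym (var-in-S x x∈S)) m
    ... | no x∉S with var-in-component x x∉S
    ...   | _ , _ , _ , _ , r , ex =
            subst (_∈ C i) (sym ex) (to (IsIso.preserves-col r _ (inj₂ (∈-componentOf x∉S)) i) m)

  -- How the number of components of a type changes when a vertex c is
  -- added as the new vertex variable 0.
  module NewVertex {s v} {X : Fin s → Subset n} {ρ : Fin v → Fin n} {A : Subset n}
                   {Z : Fin s → Subset n} {ρ′ : Fin (suc v) → Fin n} (A∈ : A ∈L components) where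

    ρ′⁻ : Fin v → Fin n
    ρ′⁻ x = ρ′ (suc x)

    IsoNew : Fin n → Subset n → Set
    IsoNew c B = Iso B X (extendEnv c ρ) A Z ρ′

    isoNew? : ∀ c B → Dec (IsoNew c B)
    isoNew? c B = iso?

    isoOld? : ∀ B → Dec (Iso B X ρ A Z ρ′⁻)
    isoOld? B = iso?

    private
      new∈A⇒c∈B : ∀ {c B} → ρ′ zero ∈ A → ρ′ zero ∉ S → IsoNew c B → c ∈ B
      new∈A⇒c∈B {c} {B} new∈A new∉S (ψ , ψ⁻ , r) = [ absurd , (λ w∈B → subst (_∈ B) (sym c≡) w∈B) ]′ (maps-from _ new′)
        where
          open IsIso r
          new′ = inj₂ new∈A
          absurd : ψ⁻ (ρ′ zero) ∈ S → c ∈ B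
          absurd w∈S = ⊥-elim (new∉S (subst (_∈ S) (trans (sym (fixes-S _ w∈S)) (inverseʳ _ new′)) w∈S))
          c≡ : c ≡ ψ⁻ (ρ′ zero)
          c≡ = from (preserves-var _ (maps-from _ new′) zero) (sym (inverseʳ _ new′))

    typeCount-new∈S : ∀ {c} → c ∈ S → ρ′ zero ≡ c → typeCount X (extendEnv c ρ) A Z ρ′ ≡ typeCount X ρ A Z ρ′⁻
    typeCount-new∈S {c} c∈S e = count-cong _ _ components (λ B _ → dropVar) (λ B B∈ → add B B∈)
      where
        add : ∀ B → B ∈L components → Iso B X ρ A Z ρ′⁻ → IsoNew c B
        add B B∈ (ψ , ψ⁻ , r) = addVar r new
          where
            new : ∀ w → w ∈S∪ B → (c ≡ w ⇔ ρ′ zero ≡ ψ w)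
            new w (inj₁ w∈S) = subst (λ t → c ≡ w ⇔ ρ′ zero ≡ t) (sym (IsIso.fixes-S r w w∈S))
                                     (mk⇔ (trans e) (trans (sym e)))
            new w (inj₂ w∈B) = mk⇔ (λ c≡w → ⊥-elim (component-∉S B∈ w∈B (subst (_∈ S) c≡w c∈S)))
                                   (λ e′ → ⊥-elim (component-∉S A∈ (iso-maps-component B∈ r w w∈B)
                                                                   (subst (_∈ S) (trans (sym e) e′) c∈S)))

    typeCount-new∈S-elsewhere : ∀ {c} → c ∈ S → ρ′ zero ≢ c → typeCount X (extendEnv c ρ) A Z ρ′ ≡ 0
    typeCount-new∈S-elsewhere {c} c∈S ne = count≡0 _ components λ B _ (ψ , ψ⁻ , r) →
      ne (trans (to (IsIso.preserves-var r c (inj₁ c∈S) zero) refl) (IsIso.fixes-S r c c∈S))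

    typeCount-new∉S-at-S : ∀ {c} → c ∉ S → ρ′ zero ∈ S → typeCount X (extendEnv c ρ) A Z ρ′ ≡ 0
    typeCount-new∉S-at-S {c} c∉S new∈S = count≡0 _ components λ B _ (ψ , ψ⁻ , r) →
      c∉S (subst (_∈ S) (sym (from (IsIso.preserves-var r _ (inj₁ new∈S) zero) (sym (IsIso.fixes-S r _ new∈S)))) new∈S)

    -- If the new variable lies in A, only the component of c can have the type.
    module _ {c} (c∉S : c ∉ S) (new∉S : ρ′ zero ∉ S) (new∈A : ρ′ zero ∈ A) where

      typeCount-new∈A≡1 : IsoNew c (componentOf c) → typeCount X (extendEnv c ρ) A Z ρ′ ≡ 1
      typeCount-new∈A≡1 i = count≡1 (isoNew? c) components components-unique (componentOf∈components c∉S) only i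
        where
          only : ∀ B → B ∈L components → IsoNew c B → B ≡ componentOf c
          only B B∈ i′ = sym (componentOf-member B∈ (new∈A⇒c∈B new∈A new∉S i′))

      typeCount-new∈A≡0 : ¬ IsoNew c (componentOf c) → typeCount X (extendEnv c ρ) A Z ρ′ ≡ 0
      typeCount-new∈A≡0 ¬i = count≡0 (isoNew? c) components λ B B∈ i′ →
        ¬i (iso-subst-source (sym (componentOf-member B∈ (new∈A⇒c∈B new∈A new∉S i′))) i′)

    typeCount-new∉S∪A : ∀ {c} → c ∉ S → ρ′ zero ∉ S → ρ′ zero ∉ A →
                        typeCount X (extendEnv c ρ) A Z ρ′ ≡
                        count (λ B → isoOld? B ×-dec ¬? (B ≟ₛ componentOf c)) components
    typeCount-new∉S∪A {c} c∉S new∉S new∉A = count-cong _ _ components drop add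
      where
        new∉S∪A : ∀ {w} → w ∈S∪ A → ρ′ zero ≢ w
        new∉S∪A (inj₁ w∈S) refl = new∉S w∈S
        new∉S∪A (inj₂ w∈A) refl = new∉A w∈A
        drop : ∀ B → B ∈L components → IsoNew c B → Iso B X ρ A Z ρ′⁻ × B ≢ componentOf c
        drop B B∈ i@(ψ , ψ⁻ , r) = dropVar i , λ { refl → new∉S∪A (maps-to c (inj₂ c∈B)) (to (preserves-var c (inj₂ c∈B) zero) refl) }
          where
            open IsIso r
            c∈B = ∈-componentOf c∉S
        add : ∀ B → B ∈L components → Iso B X ρ A Z ρ′⁻ × B ≢ componentOf c → IsoNew c B
        add B B∈ ((ψ , ψ⁻ , r) , B≢) = addVar r λ w m →
          mk⇔ (λ { refl → ⊥-elim (c∉S∪B m) }) (λ e → ⊥-elim (new∉S∪A (IsIso.maps-to r w m) e))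
          where
            c∉S∪B : c ∈S∪ B → ⊥
            c∉S∪B (inj₁ c∈S) = c∉S c∈S
            c∉S∪B (inj₂ c∈B) = B≢ (sym (componentOf-member B∈ c∈B))

  module VertexMove {s v} {X₁ X₂ : Fin s → Subset n} {ρ₁ ρ₂ : Fin v → Fin n} {T T′ : ℕ}
                    (sim : Similar T X₁ ρ₁ X₂ ρ₂) where

    respond-in-S : ∀ {u} → T′ ≤ T → u ∈ S → Similar T′ X₁ (extendEnv u ρ₁) X₂ (extendEnv u ρ₂)
    respond-in-S {u} T′≤T u∈S = similar (sets-on-S sim) vars counts
      where
        vars : ∀ w → w ∈ S → ∀ x → (extendEnv u ρ₁ x ≡ w ⇔ extendEnv u ρ₂ x ≡ w)
        vars w m zero    = ⇔.refl
        vars w m (suc x) = vars-on-S sim w m x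
        counts : ∀ A → A ∈L components → ∀ Z ρ′ →
                 typeCount X₁ (extendEnv u ρ₁) A Z ρ′ ≈[ T′ ] typeCount X₂ (extendEnv u ρ₂) A Z ρ′
        counts A A∈ Z ρ′ = by-cases (ρ′ zero Fin.≟ u)
          where
            module N₁ = NewVertex {X = X₁} {ρ₁} {A} {Z} {ρ′} A∈
            module N₂ = NewVertex {X = X₂} {ρ₂} {A} {Z} {ρ′} A∈
            by-cases : Dec (ρ′ zero ≡ u) → _
            by-cases (yes e) = subst₂ (_≈[ T′ ]_) (sym (N₁.typeCount-new∈S u∈S e)) (sym (N₂.typeCount-new∈S u∈S e))
                                      (≈-mono T′≤T (type-counts sim A A∈ Z N₁.ρ′⁻))
            by-cases (no ne) = inj₁ (trans (N₁.typeCount-new∈S-elsewhere u∈S ne)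
                                           (sym (N₂.typeCount-new∈S-elsewhere u∈S ne)))

    -- r matches the component of u with a component B₂ on the right; the answer is ψ u.
    module Outside {u} (T′<T : T′ < T) (u∉S : u ∉ S) {B₂ ψ ψ⁻} (B₂∈ : B₂ ∈L components)
                   (r : IsIso ψ ψ⁻ (componentOf u) X₁ ρ₁ B₂ X₂ ρ₂) where

      open IsIso r
      B₁∈ = componentOf∈components u∉S
      u∈B₁ = ∈-componentOf u∉S
      u′∈B₂ = iso-maps-component B₁∈ r u u∈B₁
      u′∉S = component-∉S B₂∈ u′∈B₂
      B₂∈′ = componentOf∈components u′∉S

      B₂≡ : componentOf (ψ u) ≡ B₂
      B₂≡ = componentOf-member B₂∈ u′∈B₂

      iso-components : Iso (componentOf u) X₁ ρ₁ (componentOf (ψ u)) X₂ ρ₂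
      iso-components = subst (λ B → Iso _ X₁ ρ₁ B X₂ ρ₂) (sym B₂≡) (ψ , ψ⁻ , r)

      iso-extended : Iso (componentOf u) X₁ (extendEnv u ρ₁) (componentOf (ψ u)) X₂ (extendEnv (ψ u) ρ₂)
      iso-extended = subst (λ B → Iso _ X₁ (extendEnv u ρ₁) B X₂ (extendEnv (ψ u) ρ₂)) (sym B₂≡)
        (addVar {ρ′ = extendEnv (ψ u) ρ₂} r λ w m →
           mk⇔ (cong ψ) (λ e → trans (sym (inverseˡ u (inj₂ u∈B₁))) (trans (cong ψ⁻ e) (inverseˡ w m))))

      vars : ∀ w → w ∈ S → ∀ x → (extendEnv u ρ₁ x ≡ w ⇔ extendEnv (ψ u) ρ₂ x ≡ w)
      vars w m zero    = mk⇔ (λ { refl → ⊥-elim (u∉S m) }) (λ { refl → ⊥-elim (u′∉S m) })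
      vars w m (suc x) = vars-on-S sim w m x

      module _ {A} (A∈ : A ∈L components) (Z : Fin s → Subset n) (ρ′ : Fin (suc v) → Fin n) where

        module N₁ = NewVertex {X = X₁} {ρ₁} {A} {Z} {ρ′} A∈
        module N₂ = NewVertex {X = X₂} {ρ₂} {A} {Z} {ρ′} A∈

        -- Without the new variable, the components of u and ψ u have equal
        -- types; removing them lowers both counts by one or by zero.
        counts-without : count (λ B → N₁.isoOld? B ×-dec ¬? (B ≟ₛ componentOf u)) components ≈[ T′ ]
                         count (λ B → N₂.isoOld? B ×-dec ¬? (B ≟ₛ componentOf (ψ u))) components
        counts-without with N₁.isoOld? (componentOf u)
        ... | yes i = ≈-pred (subst₂ (_≈[ T ]_)
                        (count-remove N₁.isoOld? _≟ₛ_ components components-unique B₁∈ i)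
                        (count-remove N₂.isoOld? _≟ₛ_ components components-unique B₂∈′ (iso-trans (iso-sym iso-components) i))
                        (type-counts sim A A∈ Z N₁.ρ′⁻)) T′<T
        ... | no ¬i = subst₂ (_≈[ T′ ]_)
                        (count-cong N₁.isoOld? _ components (λ B _ i′ → i′ , λ { refl → ¬i i′ }) (λ _ _ → proj₁))
                        (count-cong N₂.isoOld? _ components
                           (λ B _ i′ → i′ , λ { refl → ¬i (iso-trans iso-components i′) }) (λ _ _ → proj₁))
                        (≈-mono (<⇒≤ T′<T) (type-counts sim A A∈ Z N₁.ρ′⁻))

        counts : Dec (ρ′ zero ∈ S) → Dec (ρ′ zero ∈ A) →
                 typeCount X₁ (extendEnv u ρ₁) A Z ρ′ ≈[ T′ ] typeCount X₂ (extendEnv (ψ u) ρ₂) A Z ρ′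
        counts (yes new∈S) _ = inj₁ (trans (N₁.typeCount-new∉S-at-S u∉S new∈S)
                                           (sym (N₂.typeCount-new∉S-at-S u′∉S new∈S)))
        counts (no new∉S) (yes new∈A) with N₁.isoNew? u (componentOf u)
        ... | yes i = inj₁ (trans (N₁.typeCount-new∈A≡1 u∉S new∉S new∈A i)
                                  (sym (N₂.typeCount-new∈A≡1 u′∉S new∉S new∈A (iso-trans (iso-sym iso-extended) i))))
        ... | no ¬i = inj₁ (trans (N₁.typeCount-new∈A≡0 u∉S new∉S new∈A ¬i)
                                  (sym (N₂.typeCount-new∈A≡0 u′∉S new∉S new∈A (λ i₂ → ¬i (iso-trans iso-extended i₂)))))
        counts (no new∉S) (no new∉A) =
          subst₂ (_≈[ T′ ]_) (sym (N₁.typeCount-new∉S∪A u∉S new∉S new∉A)) (sym (N₂.typeCount-new∉S∪A u′∉S new∉S new∉A))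
            counts-without

      similar-after : Similar T′ X₁ (extendEnv u ρ₁) X₂ (extendEnv (ψ u) ρ₂)
      similar-after = similar (sets-on-S sim) vars (λ A A∈ Z ρ′ → counts A∈ Z ρ′ (ρ′ zero ∈? S) (ρ′ zero ∈? A))

    respond-outside-S : ∀ {u} → T′ < T → u ∉ S → ∃ λ u′ → Similar T′ X₁ (extendEnv u ρ₁) X₂ (extendEnv u′ ρ₂)
    respond-outside-S {u} T′<T u∉S =
      let (B₂ , B₂∈ , ψ , ψ⁻ , r) = partner sim (componentOf∈components u∉S)
      in ψ u , Outside.similar-after T′<T u∉S B₂∈ r

  -- Classes of components are indexed by a representative R on the left, and
  -- cut R B ⊆ R is the pattern in which U cuts B, transported to R.
  module SetMove {s v} {X₁ X₂ : Fin s → Subset n} {ρ₁ ρ₂ : Fin v → Fin n} {T T′ : ℕ}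
                 (bound : ∀ R → R ∈L components → 2 ^ ∣ R ∣ * suc T′ ≤ suc T)
                 (sim : Similar T X₁ ρ₁ X₂ ρ₂) (U : Subset n) where

    ∅ : Subset n
    ∅ = Subset.⊥

    open Multiset (_≟ₛ_ {n})
    open Pairing (_≟ₛ_ {n}) ∅

    -- On a negative decision both are the identity; such values are never used.
    forward backward : ∀ {B A} {X X′ : Fin s → Subset n} {ρ ρ′ : Fin v → Fin n} → Dec (Iso B X ρ A X′ ρ′) → Fin n → Fin n
    forward  (yes (ψ , _)) = ψ
    forward  (no _) w      = w
    backward (yes (_ , ψ⁻ , _)) = ψ⁻
    backward (no _) w           = w

    withS : Subset n → Subset n
    withS κ = κ ∪ (U ∩ S)

    module _ {κ R} (κ⊆R : κ ⊆ R) (R∈ : R ∈L components) where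

      withS-on-S : ∀ {w} → w ∈ S → (w ∈ U ⇔ w ∈ withS κ)
      withS-on-S w∈S = mk⇔ (λ m → x∈p∪q⁺ (inj₂ (x∈p∩q⁺ (m , w∈S))))
        (λ m → [ (λ w∈κ → ⊥-elim (component-∉S R∈ (κ⊆R w∈κ) w∈S)) , (λ m′ → proj₁ (x∈p∩q⁻ U S m′)) ]′ (x∈p∪q⁻ κ (U ∩ S) m))

      withS-on-R : ∀ {r} → r ∈ R → (r ∈ κ ⇔ r ∈ withS κ)
      withS-on-R r∈R = mk⇔ (λ m → x∈p∪q⁺ (inj₁ m))
        (λ m → [ (λ r∈κ → r∈κ) , (λ m′ → ⊥-elim (component-∉S R∈ r∈R (proj₂ (x∈p∩q⁻ U S m′)))) ]′ (x∈p∪q⁻ κ (U ∩ S) m))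

    class₁? : ∀ R B → Dec (Iso B X₁ ρ₁ R X₁ ρ₁)
    class₁? R B = iso?

    class₂? : ∀ R B′ → Dec (Iso B′ X₂ ρ₂ R X₁ ρ₁)
    class₂? R B′ = iso?

    class₁ class₂ : Subset n → List (Subset n)
    class₁ R = filter (class₁? R) components
    class₂ R = filter (class₂? R) components

    cutVia : ∀ {B R} → Dec (Iso B X₁ ρ₁ R X₁ ρ₁) → Subset n
    cutVia {R = R} d = subsetOf (λ r → (r ∈? R) ×-dec (backward d r ∈? U))

    cut : Subset n → Subset n → Subset n
    cut R B = cutVia (class₁? R B)

    cuts₁ : Subset n → List (Subset n)
    cuts₁ R = map (cut R) (class₁ R)

    -- Opaque, since unfolding the rebalancing makes conversion checking blow up.
    opaque
      cuts₂ : Subset n → List (Subset n)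
      cuts₂ R = Rebalance.rebalance ∅ T′ (subsetsOf R) (cuts₁ R) (length (class₂ R))

    cutOf : Subset n → Subset n → Subset n
    cutOf R = keyOf (class₂ R) (cuts₂ R)

    representative : Subset n → Subset n
    representative B′ = findOr ∅ (λ R → class₂? R B′) components

    representative-spec : ∀ {B′} → B′ ∈L components →
                          representative B′ ∈L components × Iso B′ X₂ ρ₂ (representative B′) X₁ ρ₁
    representative-spec {B′} B′∈ =
      let (R , R∈ , i) = partner (similar-sym sim) B′∈ in findOr-spec ∅ (λ R → class₂? R B′) components R∈ i

    Chosen : Subset n → Fin n → Set
    Chosen B′ w = forward (class₂? (representative B′) B′) w ∈ cutOf (representative B′) B′

    answer? : ∀ w → Dec ((w ∈ S × w ∈ U) ⊎ (w ∉ S × Chosen (componentOf w) w))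
    answer? w = ((w ∈? S) ×-dec (w ∈? U)) ⊎-dec (¬? (w ∈? S) ×-dec (_ ∈? _))

    U′ : Subset n
    U′ = subsetOf answer?

    ∈-U′⁻ : ∀ {w} → w ∈ U′ → (w ∈ S × w ∈ U) ⊎ (w ∉ S × Chosen (componentOf w) w)
    ∈-U′⁻ = ∈-subsetOf⁻ answer?

    ∈-U′⁺ : ∀ {w} → (w ∈ S × w ∈ U) ⊎ (w ∉ S × Chosen (componentOf w) w) → w ∈ U′
    ∈-U′⁺ = ∈-subsetOf⁺ answer?

    U′-on-S : ∀ {w} → w ∈ S → (w ∈ U′ ⇔ w ∈ U)
    U′-on-S {w} w∈S = mk⇔ (λ m → on-S (∈-U′⁻ m)) (λ m → ∈-U′⁺ (inj₁ (w∈S , m)))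
      where
        on-S : (w ∈ S × w ∈ U) ⊎ (w ∉ S × Chosen (componentOf w) w) → w ∈ U
        on-S (inj₁ (_ , m))   = m
        on-S (inj₂ (w∉S , _)) = ⊥-elim (w∉S w∈S)

    U′-on-component : ∀ {w B′} → B′ ∈L components → w ∈ B′ → (w ∈ U′ ⇔ Chosen B′ w)
    U′-on-component {w} {B′} B′∈ w∈B′ = mk⇔ (λ m → off-S (∈-U′⁻ m)) (λ c → ∈-U′⁺ (inj₂ (w∉S , chosen⁺ c)))
      where
        w∉S = component-∉S B′∈ w∈B′
        B≡ : componentOf w ≡ B′
        B≡ = componentOf-member B′∈ w∈B′
        chosen⁺ : Chosen B′ w → Chosen (componentOf w) w
        chosen⁺ = subst (λ B → Chosen B w) (sym B≡)
        off-S : (w ∈ S × w ∈ U) ⊎ (w ∉ S × Chosen (componentOf w) w) → Chosen B′ w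
        off-S (inj₁ (w∈S , _)) = ⊥-elim (w∉S w∈S)
        off-S (inj₂ (_ , c))   = subst (λ B → Chosen B w) B≡ c

    cutVia⊆ : ∀ {B R} (d : Dec (Iso B X₁ ρ₁ R X₁ ρ₁)) → cutVia d ⊆ R
    cutVia⊆ {R = R} d m = proj₁ (∈-subsetOf⁻ (λ r → (r ∈? R) ×-dec (backward d r ∈? U)) m)

    cuts₁⊆ : ∀ R κ → κ ∈L cuts₁ R → κ ∈L subsetsOf R
    cuts₁⊆ R κ m = ∈-subsetsOf⁺ R κ (λ {x} x∈κ → cutVia⊆ (class₁? R (proj₁ κ-origin)) (subst (x ∈_) (proj₂ (proj₂ κ-origin)) x∈κ))
      where
        κ-origin : ∃ λ B → B ∈L class₁ R × κ ≡ cut R B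
        κ-origin = ∈-map⁻ (cut R) m

    rebalance-bound : ∀ {R} → R ∈L components → length (subsetsOf R) * suc T′ ≤ suc T
    rebalance-bound {R} R∈ = subst (λ m → m * suc T′ ≤ suc T) (sym (length-subsetsOf R)) (bound R R∈)

    class-sizes : ∀ {R} → R ∈L components → length (cuts₁ R) ≈[ T ] length (class₂ R)
    class-sizes {R} R∈ = subst₂ (_≈[ T ]_)
      (sym (trans (length-map (cut R) (class₁ R)) (length-filter≡count (class₁? R) components)))
      (sym (length-filter≡count (class₂? R) components))
      (type-counts sim R R∈ X₁ ρ₁)

    opaque
      unfolding cuts₂
      cuts₂-spec : ∀ {R} → R ∈L components →
        length (cuts₂ R) ≡ length (class₂ R) × (∀ κ → κ ∈L cuts₂ R → κ ∈L subsetsOf R) ×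
        (∀ κ → κ ∈L subsetsOf R → multiplicity κ (cuts₁ R) ≈[ T′ ] multiplicity κ (cuts₂ R))
      cuts₂-spec {R} R∈ = Rebalance.rebalance-spec ∅ T′ (subsetsOf R) (cuts₁ R) T (length (class₂ R))
        (subsetsOf-unique R) (cuts₁⊆ R) (rebalance-bound R∈) (class-sizes R∈)

    cutOf⊆ : ∀ {R} → R ∈L components → ∀ B′ → cutOf R B′ ⊆ R
    cutOf⊆ {R} R∈ B′ {x} m = [ (λ κ∈ → ∈-subsetsOf⁻ R _ (proj₁ (proj₂ (cuts₂-spec R∈)) _ κ∈) m) ,
                                   (λ κ≡⊥ → ⊥⊆ {p = R} (subst (x ∈_) κ≡⊥ m)) ]′ (keyOf-∈ (class₂ R) (cuts₂ R) B′)

    iso-withS₁ : ∀ {B R} → B ∈L components → R ∈L components → (d : Dec (Iso B X₁ ρ₁ R X₁ ρ₁)) → Iso B X₁ ρ₁ R X₁ ρ₁ →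
                 Iso B (extendEnv U X₁) ρ₁ R (extendEnv (withS (cutVia d)) X₁) ρ₁
    iso-withS₁ _ _ (no ¬i) i = ⊥-elim (¬i i)
    iso-withS₁ {B} {R} B∈ R∈ d@(yes (ψ , ψ⁻ , r)) _ = addSet r new
      where
        open IsIso r
        P? : ∀ r′ → Dec (r′ ∈ R × ψ⁻ r′ ∈ U)
        P? r′ = (r′ ∈? R) ×-dec (ψ⁻ r′ ∈? U)
        new : ∀ w → w ∈S∪ B → (w ∈ U ⇔ ψ w ∈ withS (subsetOf P?))
        new w (inj₁ w∈S) = subst (λ t → w ∈ U ⇔ t ∈ withS (subsetOf P?)) (sym (fixes-S w w∈S)) (withS-on-S (cutVia⊆ d) R∈ w∈S)
        new w (inj₂ w∈B) = ⇔.trans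
          (mk⇔ (λ m → ∈-subsetOf⁺ P? (ψw∈R , subst (_∈ U) (sym (inverseˡ w (inj₂ w∈B))) m))
               (λ m → subst (_∈ U) (inverseˡ w (inj₂ w∈B)) (proj₂ (∈-subsetOf⁻ P? m))))
          (withS-on-R (cutVia⊆ d) R∈ ψw∈R)
          where ψw∈R = iso-maps-component B∈ r w w∈B

    iso-withS₂ : ∀ {B′ R κ} → B′ ∈L components → R ∈L components → κ ⊆ R →
                 (d : Dec (Iso B′ X₂ ρ₂ R X₁ ρ₁)) → Iso B′ X₂ ρ₂ R X₁ ρ₁ →
                 (∀ w → w ∈ B′ → (w ∈ U′ ⇔ forward d w ∈ κ)) →
                 Iso B′ (extendEnv U′ X₂) ρ₂ R (extendEnv (withS κ) X₁) ρ₁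
    iso-withS₂ _ _ _ (no ¬i) i _ = ⊥-elim (¬i i)
    iso-withS₂ {B′} {R} {κ} B′∈ R∈ κ⊆R (yes (ψ , ψ⁻ , r)) _ h = addSet r new
      where
        new : ∀ w → w ∈S∪ B′ → (w ∈ U′ ⇔ ψ w ∈ withS κ)
        new w (inj₁ w∈S) = ⇔.trans (U′-on-S w∈S)
          (subst (λ t → w ∈ U ⇔ t ∈ withS κ) (sym (IsIso.fixes-S r w w∈S)) (withS-on-S κ⊆R R∈ w∈S))
        new w (inj₂ w∈B′) = ⇔.trans (h w w∈B′) (withS-on-R κ⊆R R∈ (iso-maps-component B′∈ r w w∈B′))

    iso-class₁ : ∀ {B R} → B ∈L components → R ∈L components → Iso B X₁ ρ₁ R X₁ ρ₁ →
                 Iso B (extendEnv U X₁) ρ₁ R (extendEnv (withS (cut R B)) X₁) ρ₁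
    iso-class₁ {B} {R} B∈ R∈ = iso-withS₁ B∈ R∈ (class₁? R B)

    iso-class₂ : ∀ {B′} → B′ ∈L components →
                 Iso B′ (extendEnv U′ X₂) ρ₂ (representative B′) (extendEnv (withS (cutOf (representative B′) B′)) X₁) ρ₁
    iso-class₂ {B′} B′∈ = iso-withS₂ B′∈ (proj₁ rep) (cutOf⊆ (proj₁ rep) B′) (class₂? (representative B′) B′) (proj₂ rep)
                                      (λ w → U′-on-component B′∈)
      where rep = representative-spec B′∈

    module NewType (A : Subset n) (Z : Fin (suc s) → Subset n) (ρ′ : Fin v → Fin n) where

      Z⁻ : Fin s → Subset n
      Z⁻ j = Z (suc j)

      old? : ∀ B → Dec (Iso B X₁ ρ₁ A Z⁻ ρ′)
      old? B = iso?

      new₁? : ∀ B → Dec (Iso B (extendEnv U X₁) ρ₁ A Z ρ′)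
      new₁? B = iso?

      new₂? : ∀ B → Dec (Iso B (extendEnv U′ X₂) ρ₂ A Z ρ′)
      new₂? B = iso?

      counts-absent : ¬ (0 < count old? components) → count new₁? components ≡ count new₂? components
      counts-absent none = trans
        (count≡0 new₁? components λ B B∈ i → none (count>0 old? components B∈ (dropSet i)))
        (sym (count≡0 new₂? components λ B′ B′∈ i → none
                (count>0 old? components (proj₁ (representative-spec B′∈))
                         (iso-trans (iso-sym (proj₂ (representative-spec B′∈))) (dropSet i)))))

      -- Fix a component R of the old type; the components of the new type
      -- are those of the class of R whose cut κ makes R with withS κ of the new type.
      module Present (present : 0 < count old? components) where

        R : Subset n
        R = findOr ∅ old? components

        R-spec : R ∈L components × Iso R X₁ ρ₁ A Z⁻ ρ′
        R-spec = let (_ , B∈ , i) = count>0⇒∃ old? components present in findOr-spec ∅ old? components B∈ i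

        R∈ = proj₁ R-spec
        iR = proj₂ R-spec

        via? : ∀ κ → Dec (Iso R (extendEnv (withS κ) X₁) ρ₁ A Z ρ′)
        via? κ = iso?

        count-new₁ : count new₁? components ≡ count via? (cuts₁ R)
        count-new₁ = trans (count-cong new₁? (λ B → class₁? R B ×-dec via? (cut R B)) components into from′)
          (sym (trans (count-map via? (cut R) (class₁ R)) (count-filter (λ B → via? (cut R B)) (class₁? R) components)))
          where
            into : ∀ B → B ∈L components → Iso B (extendEnv U X₁) ρ₁ A Z ρ′ →
                   Iso B X₁ ρ₁ R X₁ ρ₁ × Iso R (extendEnv (withS (cut R B)) X₁) ρ₁ A Z ρ′
            into B B∈ i = B≅R , iso-trans (iso-sym (iso-class₁ B∈ R∈ B≅R)) i
              where B≅R = iso-trans (dropSet i) (iso-sym iR)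
            from′ : ∀ B → B ∈L components → Iso B X₁ ρ₁ R X₁ ρ₁ × Iso R (extendEnv (withS (cut R B)) X₁) ρ₁ A Z ρ′ →
                    Iso B (extendEnv U X₁) ρ₁ A Z ρ′
            from′ B B∈ (B≅R , i) = iso-trans (iso-class₁ B∈ R∈ B≅R) i

        representative≡R : ∀ {B′} → Iso B′ X₂ ρ₂ A Z⁻ ρ′ → representative B′ ≡ R
        representative≡R i = findOr-cong ∅ _ old? components (λ R′ _ j → iso-trans (iso-sym j) i)
                                                               (λ R′ _ j → iso-trans i (iso-sym j))

        answer : ∀ {B′} → B′ ∈L components → Iso B′ X₂ ρ₂ A Z⁻ ρ′ →
                 Iso B′ (extendEnv U′ X₂) ρ₂ R (extendEnv (withS (cutOf R B′)) X₁) ρ₁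
        answer {B′} B′∈ i = subst (λ R′ → Iso B′ (extendEnv U′ X₂) ρ₂ R′ (extendEnv (withS (cutOf R′ B′)) X₁) ρ₁)
                                  (representative≡R i) (iso-class₂ B′∈)

        count-new₂ : count new₂? components ≡ count via? (cuts₂ R)
        count-new₂ = begin
          count new₂? components
            ≡⟨ count-cong new₂? (λ B′ → class₂? R B′ ×-dec via? (cutOf R B′)) components into from′ ⟩
          count (λ B′ → class₂? R B′ ×-dec via? (cutOf R B′)) components
            ≡⟨ count-filter (λ B′ → via? (cutOf R B′)) (class₂? R) components ⟨
          count (λ B′ → via? (cutOf R B′)) (class₂ R)
            ≡⟨ count-map via? (cutOf R) (class₂ R) ⟨
          count via? (map (cutOf R) (class₂ R))
            ≡⟨ cong (count via?) (map-keyOf (class₂ R) (cuts₂ R) (Unique.filter⁺ (class₂? R) components-unique)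
                                            (proj₁ (cuts₂-spec R∈))) ⟩
          count via? (cuts₂ R) ∎
          where
            open ≡-Reasoning
            into : ∀ B′ → B′ ∈L components → Iso B′ (extendEnv U′ X₂) ρ₂ A Z ρ′ →
                   Iso B′ X₂ ρ₂ R X₁ ρ₁ × Iso R (extendEnv (withS (cutOf R B′)) X₁) ρ₁ A Z ρ′
            into B′ B′∈ i = iso-trans (dropSet i) (iso-sym iR) , iso-trans (iso-sym (answer B′∈ (dropSet i))) i
            from′ : ∀ B′ → B′ ∈L components → Iso B′ X₂ ρ₂ R X₁ ρ₁ × Iso R (extendEnv (withS (cutOf R B′)) X₁) ρ₁ A Z ρ′ →
                    Iso B′ (extendEnv U′ X₂) ρ₂ A Z ρ′
            from′ B′ B′∈ (B′≅R , i) = iso-trans (answer B′∈ (iso-trans B′≅R iR)) i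

        counts-present : count new₁? components ≈[ T′ ] count new₂? components
        counts-present = subst₂ (_≈[ T′ ]_) (sym count-new₁) (sym count-new₂)
          (≈-multiplicity⇒≈-count T′ (subsetsOf R) (subsetsOf-unique R) (cuts₁ R) (cuts₂ R)
             (cuts₁⊆ R) (proj₁ (proj₂ (cuts₂-spec R∈))) (proj₂ (proj₂ (cuts₂-spec R∈))) via?)

      counts : count new₁? components ≈[ T′ ] count new₂? components
      counts = by-cases (0 <? count old? components)
        where
          by-cases : Dec (0 < count old? components) → count new₁? components ≈[ T′ ] count new₂? components
          by-cases (yes present) = Present.counts-present present
          by-cases (no absent)   = inj₁ (counts-absent absent)

    respond : Similar T′ (extendEnv U X₁) ρ₁ (extendEnv U′ X₂) ρ₂
    respond = similar sets (vars-on-S sim) (λ A _ Z ρ′ → NewType.counts A Z ρ′)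
      where
        sets : ∀ w → w ∈ S → ∀ j → (w ∈ extendEnv U X₁ j ⇔ w ∈ extendEnv U′ X₂ j)
        sets w w∈S zero    = ⇔.sym (U′-on-S w∈S)
        sets w w∈S (suc j) = sets-on-S sim w w∈S j

Σ-⇔ : ∀ {A B : Set} {P : A → Set} {Q : B → Set} →
      (∀ a → ∃ λ b → P a → Q b) → (∀ b → ∃ λ a → Q b → P a) → Σ A P ⇔ Σ B Q
Σ-⇔ f g = mk⇔ (λ (a , pa) → let (b , h) = f a in b , h pa) (λ (b , qb) → let (a , h) = g b in a , h qb)

Π-⇔ : ∀ {A B : Set} {P : A → Set} {Q : B → Set} →
      (∀ b → ∃ λ a → P a → Q b) → (∀ a → ∃ λ b → Q b → P a) → (∀ a → P a) ⇔ (∀ b → Q b)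
Π-⇔ f g = mk⇔ (λ ∀P b → let (a , h) = f b in h (∀P a)) (λ ∀Q a → let (b , h) = g a in h (∀Q b))

module Game {n p} (G : Graph n) (C : Colors n p) (S : Subset n) (k : ℕ) where

  open Similarity G C S

  -- Counts capped at 2^(kq) are compared up to threshold 2^(kq) - 1, so that
  -- threshold q + 1 = 2^(kq) shrinks by the factor 2^k ≥ 2^|R| per quantifier.
  threshold : ℕ → ℕ
  threshold q = 2 ^ (k * q) ∸ 1

  suc-threshold : ∀ q → suc (threshold q) ≡ 2 ^ (k * q)
  suc-threshold q = m+[n∸m]≡n (m^n>0 2 (k * q))

  threshold-mono : ∀ {a b} → a ≤ b → threshold a ≤ threshold b
  threshold-mono a≤b = ∸-monoˡ-≤ 1 (^-monoʳ-≤ 2 (*-monoʳ-≤ k a≤b))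

  module _ (small : ∀ B → B ∈L components → ∣ S ∣ + ∣ B ∣ ≤ k) where

    component≤k : ∀ {B} → B ∈L components → ∣ B ∣ ≤ k
    component≤k {B} B∈ = m+n≤o⇒n≤o ∣ S ∣ (small B B∈)

    threshold-< : ∀ {B} → B ∈L components → ∀ q → threshold q < threshold (suc q)
    threshold-< B∈ q = ∸-monoˡ-< (^-monoʳ-< 2 (s≤s (s≤s z≤n)) kq<) (m^n>0 2 (k * q))
      where
        1≤k : 1 ≤ k
        1≤k = ≤-trans (≤-<-trans z≤n (x∈p⇒∣p-x∣<∣p∣ (proj₂ (component-nonempty B∈)))) (component≤k B∈)
        kq< : k * q < k * suc q
        kq< = subst (k * q <_) (sym (*-suc k q)) (+-monoˡ-≤ (k * q) 1≤k)

    threshold-bound : ∀ q R → R ∈L components → 2 ^ ∣ R ∣ * suc (threshold q) ≤ suc (threshold (suc q))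
    threshold-bound q R R∈ = begin
      2 ^ ∣ R ∣ * suc (threshold q) ≡⟨ cong (2 ^ ∣ R ∣ *_) (suc-threshold q) ⟩
      2 ^ ∣ R ∣ * 2 ^ (k * q)       ≤⟨ *-monoˡ-≤ (2 ^ (k * q)) (^-monoʳ-≤ 2 (component≤k R∈)) ⟩
      2 ^ k * 2 ^ (k * q)           ≡⟨ ^-distribˡ-+-* 2 k (k * q) ⟨
      2 ^ (k + k * q)               ≡⟨ cong (2 ^_) (*-suc k q) ⟨
      2 ^ (k * suc q)               ≡⟨ suc-threshold (suc q) ⟨
      suc (threshold (suc q))       ∎
      where open ≤-Reasoning

    module _ {s v} {X₁ X₂ : Fin s → Subset n} {ρ₁ ρ₂ : Fin v → Fin n} {q : ℕ}
             (sim : Similar (threshold (suc q)) X₁ ρ₁ X₂ ρ₂) where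

      vertex-move : ∀ u → ∃ λ u′ → Similar (threshold q) X₁ (extendEnv u ρ₁) X₂ (extendEnv u′ ρ₂)
      vertex-move u with u ∈? S
      ... | yes u∈S = u , VertexMove.respond-in-S sim (threshold-mono (n≤1+n q)) u∈S
      ... | no u∉S  = VertexMove.respond-outside-S sim (threshold-< (componentOf∈components u∉S) q) u∉S

      set-move : ∀ U → ∃ λ U′ → Similar (threshold q) (extendEnv U X₁) ρ₁ (extendEnv U′ X₂) ρ₂
      set-move U = SetMove.U′ (threshold-bound q) sim U , SetMove.respond (threshold-bound q) sim U

    similar⇒⇔₂ : ∀ {v s} (φ ψ : Formula p v s) {X₁ X₂ : Fin s → Subset n} {ρ₁ ρ₂ : Fin v → Fin n} →
                 Similar (threshold (quantifiers φ + quantifiers ψ)) X₁ ρ₁ X₂ ρ₂ →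
                 (Sat G C ρ₁ X₁ φ ⇔ Sat G C ρ₂ X₂ φ) × (Sat G C ρ₁ X₁ ψ ⇔ Sat G C ρ₂ X₂ ψ)

    similar⇒⇔ : ∀ {v s} (φ : Formula p v s) {X₁ X₂ : Fin s → Subset n} {ρ₁ ρ₂ : Fin v → Fin n} →
                Similar (threshold (quantifiers φ)) X₁ ρ₁ X₂ ρ₂ → Sat G C ρ₁ X₁ φ ⇔ Sat G C ρ₂ X₂ φ
    similar⇒⇔ (edge x y) sim =
      mk⇔ (trans (sym (Atoms.adj-preserved sim x y))) (trans (Atoms.adj-preserved sim x y))
    similar⇒⇔ (equal x y) sim = mk⇔ (Atoms.≡-preserved sim x y) (Atoms.≡-preserved (similar-sym sim) x y)
    similar⇒⇔ (mem x j) sim = mk⇔ (Atoms.∈set-preserved sim x j) (Atoms.∈set-preserved (similar-sym sim) x j)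
    similar⇒⇔ (col x i) sim = mk⇔ (Atoms.∈colour-preserved sim x i) (Atoms.∈colour-preserved (similar-sym sim) x i)
    similar⇒⇔ tt sim = ⇔.refl
    similar⇒⇔ ff sim = ⇔.refl
    similar⇒⇔ (not φ) sim = let e = similar⇒⇔ φ sim in mk⇔ (λ ¬a b → ¬a (from e b)) (λ ¬b a → ¬b (to e a))
    similar⇒⇔ (and φ ψ) sim = let (e₁ , e₂) = similar⇒⇔₂ φ ψ sim in
      mk⇔ (Data.Product.map (to e₁) (to e₂)) (Data.Product.map (from e₁) (from e₂))
    similar⇒⇔ (or φ ψ) sim = let (e₁ , e₂) = similar⇒⇔₂ φ ψ sim in
      mk⇔ (Sum.map (to e₁) (to e₂)) (Sum.map (from e₁) (from e₂))
    similar⇒⇔ (imp φ ψ) sim = let (e₁ , e₂) = similar⇒⇔₂ φ ψ sim in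
      mk⇔ (λ f a → to e₂ (f (from e₁ a))) (λ f a → from e₂ (f (to e₁ a)))
    similar⇒⇔ (iff φ ψ) sim = let (e₁ , e₂) = similar⇒⇔₂ φ ψ sim in
      mk⇔ (λ f → ⇔.trans (⇔.sym e₁) (⇔.trans f e₂)) (λ f → ⇔.trans e₁ (⇔.trans f (⇔.sym e₂)))
    similar⇒⇔ (exV φ) sim = Σ-⇔
      (λ u → let (u′ , sim′) = vertex-move sim u in u′ , to (similar⇒⇔ φ sim′))
      (λ u → let (u′ , sim′) = vertex-move (similar-sym sim) u in u′ , to (similar⇒⇔ φ sim′))
    similar⇒⇔ (allV φ) sim = Π-⇔
      (λ u → let (u′ , sim′) = vertex-move (similar-sym sim) u in u′ , from (similar⇒⇔ φ sim′))
      (λ u → let (u′ , sim′) = vertex-move sim u in u′ , from (similar⇒⇔ φ sim′))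
    similar⇒⇔ (exS φ) sim = Σ-⇔
      (λ U → let (U′ , sim′) = set-move sim U in U′ , to (similar⇒⇔ φ sim′))
      (λ U → let (U′ , sim′) = set-move (similar-sym sim) U in U′ , to (similar⇒⇔ φ sim′))
    similar⇒⇔ (allS φ) sim = Π-⇔
      (λ U → let (U′ , sim′) = set-move (similar-sym sim) U in U′ , from (similar⇒⇔ φ sim′))
      (λ U → let (U′ , sim′) = set-move sim U in U′ , from (similar⇒⇔ φ sim′))

    similar⇒⇔₂ φ ψ sim = similar⇒⇔ φ (similar-mono (threshold-mono (m≤m+n _ _)) sim) ,
                         similar⇒⇔ ψ (similar-mono (threshold-mono (m≤n+m _ _)) sim)

  typeCount-Count : ∀ {s} (X : Fin s → Subset n) A Z ρ′ →
    Count (λ B → IsComponent G S B × SameType G S (extend C X) B (extend C Z) A) (typeCount X noVars A Z ρ′)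
  typeCount-Count X A Z ρ′ =
    filter D components , Unique.filter⁺ D components-unique , length-filter≡count D components , λ B →
      mk⇔ (λ m → let (B∈ , i) = ∈-filter⁻ D m in to (∈components⇔IsComponent B) B∈ , to iso⇔SameType i)
          (λ (c , t) → ∈-filter⁺ D (from (∈components⇔IsComponent B) c) (from iso⇔SameType t))
    where D = λ B → iso? {B = B} {X} {noVars} {A} {Z} {ρ′}

  sameShape⇒similar : ∀ {s} q (X Y : Assignment n s) → SameShape G C S k q X Y → Similar (threshold q) X noVars Y noVars
  sameShape⇒similar q X Y (same-on-S , same-counts) = similar same-on-S (λ _ _ ()) λ A A∈ Z ρ′ →
    ≈-mono (m∸n≤m _ 1) (cap-≡⇒≈ _ _ _
      (same-counts Z A (to (∈components⇔IsComponent A) A∈) _ _ (typeCount-Count X A Z ρ′) (typeCount-Count Y A Z ρ′)))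

lemma4 : ∀ {n p s : ℕ} (G : Graph n) (C : Colors n p) (k : ℕ) (S : Subset n) →
    IsViSet G k S → (φ : Formula p 0 s) → (X Y : Assignment n s) →
    SameShape G C S k (quantifiers φ) X Y →
    ((G , C) , X ⊨ φ) ⇔ ((G , C) , Y ⊨ φ)
lemma4 G C k S vi φ X Y shape =
  similar⇒⇔ small φ (sameShape⇒similar (quantifiers φ) X Y shape)
  where
    open Game G C S k
    open Components G S
    small : ∀ B → B ∈L components → ∣ S ∣ + ∣ B ∣ ≤ k
    small B B∈ = vi B (to (∈components⇔IsComponent B) B∈)
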